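{- Let $n\ge 4$ be even and let $D_{2n}=\langle a,b : a^n=b^2=e,\ ba=a^{ -1}b\rangle$. Then the characteristic polynomial of the Laplacian matrix of $CSEP(D_{2n})$ is \[\Phi(L(CSEP(D_{2n})),x)=x(x-1)^2\Big(x-\big(\tfrac n2+1\big)\Big)^{n-2}(x-2n)(x-n)^{n-2}.\]
   Context: For a finite group $G$ and $x\in G$, $[x]$ denotes the conjugacy class of $x$. The conjugacy superenhanced power graph $CSEP(G)$ is the simple graph with vertex set $G$ in which two distinct vertices $x,y$ are adjacent iff there exist $x'\in[x]$, $y'\in[y]$ lying in a common cyclic subgroup of $G$ ($x'=y'$ permitted, so distinct conjugate elements are always adjacent). The Laplacian matrix is $L=D-A$ ($D$ degree matrix, $A$ adjacency matrix); $\Phi(L,x)=\det(xI-L)$. -}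

module Defs where

open import Data.Nat as ℕ using (ℕ; zero; suc; NonZero)
open import Data.Nat.DivMod using (_mod_)
open import Data.Fin as Fin using (Fin; toℕ; splitAt; punchIn)
open import Data.Fin.Properties using () renaming (_≟_ to _≟F_)
open import Data.Bool using (Bool; true; false; not; _∧_; if_then_else_)
open import Data.Bool.Properties using () renaming (_≟_ to _≟B_)
open import Data.Sum using (inj₁; inj₂)
open import Data.Product using (_×_; _,_)
open import Data.List using (List; map; allFin; foldr; upTo)
open import Data.Bool.ListAction using (any)
open import Data.Integer as ℤ using (ℤ; +_; -_)
open import Relation.Nullary.Decidable using (⌊_⌋)

-- A finite group given concretely: carrier, operations, decidable
-- equality, and an enumeration  elt : Fin order → Elt  (a bijection).

record FiniteGroup : Set₁ where
  field
    Elt   : Set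
    _·_   : Elt → Elt → Elt
    inv   : Elt → Elt
    e     : Elt
    _==_  : Elt → Elt → Bool
    order : ℕ
    elt   : Fin order → Elt

  elements : List Elt
  elements = map elt (allFin order)

  pow : Elt → ℕ → Elt
  pow z zero    = e
  pow z (suc k) = z · pow z k

  -- the cyclic subgroup ⟨z⟩ = { z^k | 0 ≤ k < |G| }  (complete, since the
  -- order of z is at most |G|)
  inCyclic : Elt → Elt → Bool
  inCyclic z w = any (λ k → pow z k == w) (upTo order)

  csepAdj : Elt → Elt → Bool
  csepAdj x y =
    not (x == y) ∧
    any (λ z → any (λ g → any (λ h →
          inCyclic z ((g · x) · inv g) ∧ inCyclic z ((h · y) · inv h))
        elements) elements) elements

Matrix : ℕ → Set
Matrix k = Fin k → Fin k → ℤ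

sumFin : ∀ {k} → (Fin k → ℤ) → ℤ
sumFin {k} f = foldr (λ i acc → f i ℤ.+ acc) (+ 0) (allFin k)

sign : ℕ → ℤ
sign zero          = + 1
sign (suc zero)    = - (+ 1)
sign (suc (suc j)) = sign j

det : ∀ {k} → Matrix k → ℤ
det {zero}  M = + 1
det {suc k} M = sumFin (λ j →
  sign (toℕ j) ℤ.* M Fin.zero j ℤ.* det (λ r c → M (Fin.suc r) (punchIn j c)))

b2ℤ : Bool → ℤ
b2ℤ true  = + 1
b2ℤ false = + 0

laplacianCSEP : (G : FiniteGroup) → Matrix (FiniteGroup.order G)
laplacianCSEP G i j =
  if ⌊ i ≟F j ⌋
  then sumFin (λ k → b2ℤ (csepAdj (elt i) (elt k)))
  else - b2ℤ (csepAdj (elt i) (elt j))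
  where open FiniteGroup G

charPolyAt : ∀ {k} → Matrix k → ℤ → ℤ
charPolyAt M x = det (λ i j → (if ⌊ i ≟F j ⌋ then x else + 0) ℤ.- M i j)

-- Dihedral group D_{2n} = ⟨a,b | aⁿ = b² = e, ba = a⁻¹b⟩, n = suc m.
-- Element (i , s) represents a^i b^s  (s = true means b^1).

module Dihedral (m : ℕ) where
  n : ℕ
  n = suc m

  _+F_ : Fin n → Fin n → Fin n
  i +F j = (toℕ i ℕ.+ toℕ j) mod n

  negF : Fin n → Fin n
  negF i = (n ℕ.∸ toℕ i) mod n

  xorB : Bool → Bool → Bool
  xorB false t = t
  xorB true  t = not t

  D : Set
  D = Fin n × Bool

  -- a^i b^s · a^k b^t = a^(i ± k) b^(s+t)   (using b a^k = a^(-k) b)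
  mul : D → D → D
  mul (i , false) (k , t) = (i +F k , t)
  mul (i , true)  (k , t) = (i +F negF k , not t)

  invD : D → D
  invD (i , false) = (negF i , false)
  invD (i , true)  = (i , true)

  eqD : D → D → Bool
  eqD (i , s) (k , t) = ⌊ i ≟F k ⌋ ∧ ⌊ s ≟B t ⌋

  enum : Fin (n ℕ.+ n) → D
  enum x with splitAt n x
  ... | inj₁ i = (i , false)
  ... | inj₂ i = (i , true)

  group : FiniteGroup
  group = record
    { Elt = D ; _·_ = mul ; inv = invD ; e = (Fin.zero , false)
    ; _==_ = eqD ; order = n ℕ.+ n ; elt = enum }

D2n : ℕ → FiniteGroup
D2n m = Dihedral.group m

module Submission where

-- In D₂ₙ with n even the conjugates of a rotation aⁱ are a^(±i), and a cyclic subgroup that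
-- contains a reflection is {e, s}; the reflections aⁱb form two conjugacy classes according to
-- the parity of i.  Hence CSEP(D₂ₙ) is e joined to the disjoint union of K_(n−1) (the non-identity
-- rotations) and two copies of K_(n/2) (the reflections of each parity).
-- det(xI − L) is computed by deflation: if a combination of the columns with weight 1 on column 0
-- equals s·u with u₀ = 1, column operations split off the factor s and leave a matrix one size
-- smaller.  The all-ones vector gives x, the identity vertex gives x − 2n, the n − 2 remaining
-- rotation rows are then diagonal with entry x − n, and the reflection block (x − n/2 − 1)I plus
-- the parity pattern has the even and the odd indicator as eigenvectors for x − 1, leaving
-- (x − n/2 − 1)I of size n − 2.

open import Defs
open import Data.Nat using (ℕ; suc; _≤_)
open import Data.Nat.Divisibility using (_∣_)
open import Data.Nat.DivMod using (_/_)
open import Data.Integer using (ℤ; +_; _-_; _*_; _^_)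
open import Relation.Binary.PropositionalEquality using (_≡_)

module Determinant where

  open import Data.Nat as ℕ using (ℕ; zero; suc; z≤n; s≤s; _<_; _≤_)
  import Data.Nat.Properties as ℕₚ
  open import Data.Integer using (ℤ; +_; -[1+_]; -_; _+_; _-_; _*_; _^_; 0ℤ; 1ℤ)
  import Data.Integer.Properties as ℤₚ
  open import Data.Integer.Tactic.RingSolver using (solve-∀)
  open import Data.Fin as Fin using (Fin; toℕ; punchIn)
  open import Data.List using (foldr; tabulate)
  open import Data.Sum using (inj₁; inj₂)
  open import Data.Product using (Σ; _,_)
  open import Data.Empty using (⊥-elim)
  open import Relation.Nullary using (yes; no)
  open import Relation.Binary.Definitions using (tri<; tri≈; tri>)
  open import Relation.Binary.PropositionalEquality

  -- ℕ-indexed matrices spare minors and blocks any Fin arithmetic; detℕ k only reads entries below k.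
  Mat : Set
  Mat = ℕ → ℕ → ℤ

  sumℕ : ℕ → (ℕ → ℤ) → ℤ
  sumℕ zero    f = 0ℤ
  sumℕ (suc k) f = f 0 + sumℕ k (λ j → f (suc j))

  punchInℕ : ℕ → ℕ → ℕ
  punchInℕ zero    c       = suc c
  punchInℕ (suc j) zero    = zero
  punchInℕ (suc j) (suc c) = suc (punchInℕ j c)

  minor : ℕ → Mat → Mat
  minor j M r c = M (suc r) (punchInℕ j c)

  detℕ : ℕ → Mat → ℤ
  detℕ zero    M = 1ℤ
  detℕ (suc k) M = sumℕ (suc k) (λ j → sign j * M 0 j * detℕ k (minor j M))

  toℕ-punchIn : ∀ {k} (j : Fin (suc k)) (c : Fin k) → toℕ (punchIn j c) ≡ punchInℕ (toℕ j) (toℕ c)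
  toℕ-punchIn Fin.zero    c           = refl
  toℕ-punchIn (Fin.suc j) Fin.zero    = refl
  toℕ-punchIn (Fin.suc j) (Fin.suc c) = cong suc (toℕ-punchIn j c)

  foldr-tabulate≡sumℕ : ∀ {A : Set} k (h : Fin k → A) (f : A → ℤ) (g : ℕ → ℤ) →
    (∀ i → g (toℕ i) ≡ f (h i)) → foldr (λ a acc → f a + acc) 0ℤ (tabulate h) ≡ sumℕ k g
  foldr-tabulate≡sumℕ zero    h f g eq = refl
  foldr-tabulate≡sumℕ (suc k) h f g eq = cong₂ _+_ (sym (eq Fin.zero))
    (foldr-tabulate≡sumℕ k (λ i → h (Fin.suc i)) f (λ j → g (suc j)) (λ i → eq (Fin.suc i)))

  sumFin≡sumℕ : ∀ k (f : Fin k → ℤ) (g : ℕ → ℤ) → (∀ i → g (toℕ i) ≡ f i) → sumFin f ≡ sumℕ k g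
  sumFin≡sumℕ k f = foldr-tabulate≡sumℕ k (λ i → i) f

  det≡detℕ : ∀ k (M : Matrix k) (A : Mat) → (∀ r c → A (toℕ r) (toℕ c) ≡ M r c) → det M ≡ detℕ k A
  det≡detℕ zero    M A eq = refl
  det≡detℕ (suc k) M A eq = sumFin≡sumℕ (suc k) _ (λ j → sign j * A 0 j * detℕ k (minor j A)) λ j →
    cong₂ (λ a d → sign (toℕ j) * a * d) (eq Fin.zero j) (sym (det≡detℕ k _ _ (minor-eq j)))
    where
    minor-eq : ∀ j r c → minor (toℕ j) A (toℕ r) (toℕ c) ≡ M (Fin.suc r) (punchIn j c)
    minor-eq j r c = trans (cong (A (suc (toℕ r))) (sym (toℕ-punchIn j c))) (eq (Fin.suc r) (punchIn j c))

  sumℕ-cong : ∀ k f g → (∀ j → j < k → f j ≡ g j) → sumℕ k f ≡ sumℕ k g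
  sumℕ-cong zero    f g eq = refl
  sumℕ-cong (suc k) f g eq = cong₂ _+_ (eq 0 (s≤s z≤n)) (sumℕ-cong k _ _ λ j p → eq (suc j) (s≤s p))

  sumℕ-≡0 : ∀ k f → (∀ j → j < k → f j ≡ 0ℤ) → sumℕ k f ≡ 0ℤ
  sumℕ-≡0 k f eq = trans (sumℕ-cong k f (λ _ → 0ℤ) eq) (sumℕ-0 k)
    where
    sumℕ-0 : ∀ k → sumℕ k (λ _ → 0ℤ) ≡ 0ℤ
    sumℕ-0 zero    = refl
    sumℕ-0 (suc k) = cong (λ s → 0ℤ + s) (sumℕ-0 k)

  sumℕ-sucʳ : ∀ k f → sumℕ (suc k) f ≡ sumℕ k f + f k
  sumℕ-sucʳ zero    f = trans (ℤₚ.+-identityʳ (f 0)) (sym (ℤₚ.+-identityˡ (f 0)))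
  sumℕ-sucʳ (suc k) f =
    trans (cong (λ s → f 0 + s) (sumℕ-sucʳ k (λ j → f (suc j)))) (sym (ℤₚ.+-assoc (f 0) _ _))

  sumℕ-+ : ∀ k f g → sumℕ k (λ t → f t + g t) ≡ sumℕ k f + sumℕ k g
  sumℕ-+ zero    f g = refl
  sumℕ-+ (suc k) f g = trans (cong (λ s → (f 0 + g 0) + s) (sumℕ-+ k _ _)) (interchange (f 0) (g 0) _ _)
    where
    interchange : ∀ a b c d → (a + b) + (c + d) ≡ (a + c) + (b + d)
    interchange = solve-∀

  sumℕ-*ˡ : ∀ k c f → sumℕ k (λ t → c * f t) ≡ c * sumℕ k f
  sumℕ-*ˡ zero    c f = sym (ℤₚ.*-zeroʳ c)
  sumℕ-*ˡ (suc k) c f = trans (cong (λ s → c * f 0 + s) (sumℕ-*ˡ k c _)) (sym (ℤₚ.*-distribˡ-+ c (f 0) _))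

  sumℕ-neg : ∀ k f → sumℕ k (λ j → - f j) ≡ - sumℕ k f
  sumℕ-neg zero    f = refl
  sumℕ-neg (suc k) f = trans (cong (λ s → - f 0 + s) (sumℕ-neg k _)) (sym (ℤₚ.neg-distrib-+ (f 0) _))

  sumℕ-- : ∀ k f g → sumℕ k (λ t → f t - g t) ≡ sumℕ k f - sumℕ k g
  sumℕ-- k f g = trans (sumℕ-+ k f (λ t → - g t)) (cong (λ s → sumℕ k f + s) (sumℕ-neg k g))

  sumℕ-1 : ∀ k → sumℕ k (λ _ → 1ℤ) ≡ + k
  sumℕ-1 zero    = refl
  sumℕ-1 (suc k) = trans (cong (λ s → 1ℤ + s) (sumℕ-1 k)) (sym (ℤₚ.pos-+ 1 k))

  sumℕ-split : ∀ a b f → sumℕ (a ℕ.+ b) f ≡ sumℕ a f + sumℕ b (λ t → f (a ℕ.+ t))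
  sumℕ-split zero    b f = sym (ℤₚ.+-identityˡ _)
  sumℕ-split (suc a) b f =
    trans (cong (λ s → f 0 + s) (sumℕ-split a b (λ j → f (suc j)))) (sym (ℤₚ.+-assoc (f 0) _ _))

  punchInℕ≤ : ∀ j c → punchInℕ j c ≤ suc c
  punchInℕ≤ zero    c       = ℕₚ.≤-refl
  punchInℕ≤ (suc j) zero    = z≤n
  punchInℕ≤ (suc j) (suc c) = s≤s (punchInℕ≤ j c)

  punchInℕ-≥ : ∀ j c → j ≤ c → punchInℕ j c ≡ suc c
  punchInℕ-≥ zero    c       p       = refl
  punchInℕ-≥ (suc j) (suc c) (s≤s p) = cong suc (punchInℕ-≥ j c p)

  punchInℕ≢ : ∀ j c → punchInℕ j c ≢ j
  punchInℕ≢ zero    c       ()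
  punchInℕ≢ (suc j) zero    ()
  punchInℕ≢ (suc j) (suc c) eq = punchInℕ≢ j c (ℕₚ.suc-injective eq)

  punchInℕ-injective : ∀ j x y → punchInℕ j x ≡ punchInℕ j y → x ≡ y
  punchInℕ-injective zero    x       y       eq = ℕₚ.suc-injective eq
  punchInℕ-injective (suc j) zero    zero    eq = refl
  punchInℕ-injective (suc j) (suc x) (suc y) eq =
    cong suc (punchInℕ-injective j x y (ℕₚ.suc-injective eq))

  punchOutℕ : ∀ j c → j ≢ c → Σ ℕ (λ c′ → punchInℕ j c′ ≡ c)
  punchOutℕ zero    zero    j≢c = ⊥-elim (j≢c refl)
  punchOutℕ zero    (suc c) j≢c = c , refl
  punchOutℕ (suc j) zero    j≢c = zero , refl
  punchOutℕ (suc j) (suc c) j≢c with punchOutℕ j c (λ e → j≢c (cong suc e))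
  ... | c′ , e = suc c′ , cong suc e

  punchInℕ<⇒< : ∀ k j c′ → j < suc k → punchInℕ j c′ < suc k → c′ < k
  punchInℕ<⇒< k j c′ j<1+k p<1+k with ℕₚ.≤-<-connex j c′
  ... | inj₁ j≤c′ = ℕₚ.≤-pred (subst (_< suc k) (punchInℕ-≥ j c′ j≤c′) p<1+k)
  ... | inj₂ c′<j = ℕₚ.<-≤-trans c′<j (ℕₚ.≤-pred j<1+k)

  detℕ-cong< : ∀ k A B → (∀ r c → r < k → c < k → A r c ≡ B r c) → detℕ k A ≡ detℕ k B
  detℕ-cong< zero    A B eq = refl
  detℕ-cong< (suc k) A B eq = sumℕ-cong (suc k) _ _ λ j j<1+k →
    cong₂ (λ a d → sign j * a * d) (eq 0 j (s≤s z≤n) j<1+k) (detℕ-cong< k _ _ λ r c r<k c<k →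
      eq (suc r) (punchInℕ j c) (s≤s r<k) (ℕₚ.≤-trans (s≤s (punchInℕ≤ j c)) (s≤s c<k)))

  detℕ-cong : ∀ k A B → (∀ r c → A r c ≡ B r c) → detℕ k A ≡ detℕ k B
  detℕ-cong k A B eq = detℕ-cong< k A B (λ r c _ _ → eq r c)

  swapAdj : ℕ → ℕ → ℕ
  swapAdj zero    zero          = 1
  swapAdj zero    (suc zero)    = 0
  swapAdj zero    (suc (suc c)) = suc (suc c)
  swapAdj (suc p) zero          = zero
  swapAdj (suc p) (suc c)       = suc (swapAdj p c)

  swapAdj-< : ∀ p j → j < p → swapAdj p j ≡ j
  swapAdj-< (suc p) zero    h       = refl
  swapAdj-< (suc p) (suc j) (s≤s h) = cong suc (swapAdj-< p j h)

  swapAdj-≡ : ∀ p → swapAdj p p ≡ suc p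
  swapAdj-≡ zero    = refl
  swapAdj-≡ (suc p) = cong suc (swapAdj-≡ p)

  swapAdj-suc : ∀ p → swapAdj p (suc p) ≡ p
  swapAdj-suc zero    = refl
  swapAdj-suc (suc p) = cong suc (swapAdj-suc p)

  swapAdj-> : ∀ p j → suc (suc p) ≤ j → swapAdj p j ≡ j
  swapAdj-> zero    (suc (suc j)) h       = refl
  swapAdj-> zero    (suc zero)    (s≤s ())
  swapAdj-> (suc p) (suc j)       (s≤s h) = cong suc (swapAdj-> p j h)

  swapAdj-punchIn-< : ∀ p j c → suc j ≤ p → swapAdj p (punchInℕ j c) ≡ punchInℕ j (swapAdj (ℕ.pred p) c)
  swapAdj-punchIn-< (suc p)       zero    c       h               = refl
  swapAdj-punchIn-< (suc zero)    (suc j) c       (s≤s ())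
  swapAdj-punchIn-< (suc (suc p)) (suc j) zero    h               = refl
  swapAdj-punchIn-< (suc (suc p)) (suc j) (suc c) (s≤s (s≤s h)) =
    cong suc (swapAdj-punchIn-< (suc p) j c (s≤s h))

  swapAdj-punchIn-> : ∀ p j c → suc (suc p) ≤ j → swapAdj p (punchInℕ j c) ≡ punchInℕ j (swapAdj p c)
  swapAdj-punchIn-> zero    (suc (suc j)) zero          h       = refl
  swapAdj-punchIn-> zero    (suc (suc j)) (suc zero)    h       = refl
  swapAdj-punchIn-> zero    (suc (suc j)) (suc (suc c)) h       = refl
  swapAdj-punchIn-> zero    (suc zero)    c             (s≤s ())
  swapAdj-punchIn-> (suc p) (suc j)       zero          h       = refl
  swapAdj-punchIn-> (suc p) (suc j)       (suc c)       (s≤s h) = cong suc (swapAdj-punchIn-> p j c h)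

  swapAdj-punchIn-≡ : ∀ p c → swapAdj p (punchInℕ p c) ≡ punchInℕ (suc p) c
  swapAdj-punchIn-≡ zero    zero    = refl
  swapAdj-punchIn-≡ zero    (suc c) = refl
  swapAdj-punchIn-≡ (suc p) zero    = refl
  swapAdj-punchIn-≡ (suc p) (suc c) = cong suc (swapAdj-punchIn-≡ p c)

  swapAdj-punchIn-suc : ∀ p c → swapAdj p (punchInℕ (suc p) c) ≡ punchInℕ p c
  swapAdj-punchIn-suc zero    zero    = refl
  swapAdj-punchIn-suc zero    (suc c) = refl
  swapAdj-punchIn-suc (suc p) zero    = refl
  swapAdj-punchIn-suc (suc p) (suc c) = cong suc (swapAdj-punchIn-suc p c)

  sumℕ-swapAdj : ∀ p k f → suc p < k → sumℕ k (λ j → f (swapAdj p j)) ≡ sumℕ k f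
  sumℕ-swapAdj zero    (suc (suc k)) f h       = exchange (f 1) (f 0) _
    where
    exchange : ∀ a b c → a + (b + c) ≡ b + (a + c)
    exchange = solve-∀
  sumℕ-swapAdj zero    (suc zero)    f (s≤s ())
  sumℕ-swapAdj (suc p) (suc k)       f (s≤s h) =
    cong (λ s → f 0 + s) (sumℕ-swapAdj p k (λ j → f (suc j)) h)

  data SwapView (p j : ℕ) : Set where
    below : j < p → SwapView p j
    at    : j ≡ p → SwapView p j
    next  : j ≡ suc p → SwapView p j
    above : suc (suc p) ≤ j → SwapView p j

  swapView : ∀ p j → SwapView p j
  swapView p j with ℕₚ.<-cmp j p
  ... | tri< j<p _ _ = below j<p
  ... | tri≈ _ j≡p _ = at j≡p
  ... | tri> _ _ p<j with ℕₚ.<-cmp j (suc p)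
  ...   | tri< j<1+p _ _ = ⊥-elim (ℕₚ.<⇒≱ j<1+p p<j)
  ...   | tri≈ _ j≡1+p _ = next j≡1+p
  ...   | tri> _ _ 1+p<j = above 1+p<j

  sign-suc : ∀ j → sign (suc j) ≡ - sign j
  sign-suc zero    = refl
  sign-suc (suc j) = sym (trans (cong -_ (sign-suc j)) (ℤₚ.neg-involutive (sign j)))

  negate-right : ∀ s a d → s * a * (- d) ≡ - (s * a * d)
  negate-right = solve-∀

  negate-left : ∀ s a d → (- s) * a * d ≡ - (s * a * d)
  negate-left = solve-∀

  -- In the row-0 expansion, column j of B pairs with column swapAdj p j of A: for j ∉ {p, p+1} the
  -- minors differ by an adjacent swap (induction), for j ∈ {p, p+1} they coincide and the signs differ.
  detℕ-swapAdj : ∀ k p A B → suc p < k → (∀ r c → B r c ≡ A r (swapAdj p c)) →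
    detℕ k B ≡ - detℕ k A
  detℕ-swapAdj (suc k) p A B 1+p<1+k B≡ = begin
    sumℕ (suc k) (λ j → sign j * B 0 j * detℕ k (minor j B)) ≡⟨ sumℕ-cong (suc k) _ _ term≡ ⟩
    sumℕ (suc k) (λ j → - termA (swapAdj p j))               ≡⟨ sumℕ-neg (suc k) (λ j → termA (swapAdj p j)) ⟩
    - sumℕ (suc k) (λ j → termA (swapAdj p j))               ≡⟨ cong -_ (sumℕ-swapAdj p (suc k) termA 1+p<1+k) ⟩
    - sumℕ (suc k) termA                                     ∎
    where
    open ≡-Reasoning
    termA : ℕ → ℤ
    termA j = sign j * A 0 j * detℕ k (minor j A)
    minorB : ∀ j c′ r c → swapAdj p (punchInℕ j c) ≡ c′ → minor j B r c ≡ A (suc r) c′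
    minorB j c′ r c e = trans (B≡ (suc r) (punchInℕ j c)) (cong (A (suc r)) e)
    pred-bound : ∀ {j p k} → j < p → suc p < suc k → suc (ℕ.pred p) < k
    pred-bound {p = suc p} _ (s≤s h) = h
    sign-pred : ∀ j → sign j ≡ - sign (suc j)
    sign-pred j = trans (sym (ℤₚ.neg-involutive (sign j))) (cong -_ (sym (sign-suc j)))
    term≡ : ∀ j → j < suc k → sign j * B 0 j * detℕ k (minor j B) ≡ - termA (swapAdj p j)
    term≡ j j<1+k with swapView p j
    ... | below j<p rewrite swapAdj-< p j j<p =
      trans (cong₂ (λ a d → sign j * a * d) (trans (B≡ 0 j) (cong (A 0) (swapAdj-< p j j<p)))
              (detℕ-swapAdj k (ℕ.pred p) (minor j A) (minor j B) (pred-bound j<p 1+p<1+k)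
                λ r c → minorB j _ r c (swapAdj-punchIn-< p j c j<p)))
            (negate-right (sign j) (A 0 j) _)
    ... | above 2+p≤j rewrite swapAdj-> p j 2+p≤j =
      trans (cong₂ (λ a d → sign j * a * d) (trans (B≡ 0 j) (cong (A 0) (swapAdj-> p j 2+p≤j)))
              (detℕ-swapAdj k p (minor j A) (minor j B) (ℕₚ.<-≤-trans 2+p≤j (ℕₚ.≤-pred j<1+k))
                λ r c → minorB j _ r c (swapAdj-punchIn-> p j c 2+p≤j)))
            (negate-right (sign j) (A 0 j) _)
    ... | at refl rewrite swapAdj-≡ j =
      trans (cong₂ (λ s a → s * a * detℕ k (minor j B)) (sign-pred j) (trans (B≡ 0 j) (cong (A 0) (swapAdj-≡ j))))
            (trans (cong (λ d → - sign (suc j) * A 0 (suc j) * d)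
                     (detℕ-cong k _ _ λ r c → minorB j _ r c (swapAdj-punchIn-≡ j c)))
                   (negate-left (sign (suc j)) (A 0 (suc j)) _))
    ... | next refl rewrite swapAdj-suc p =
      trans (cong₂ (λ s a → s * a * detℕ k (minor (suc p) B)) (sign-suc p) (trans (B≡ 0 (suc p)) (cong (A 0) (swapAdj-suc p))))
            (trans (cong (λ d → - sign p * A 0 p * d)
                     (detℕ-cong k _ _ λ r c → minorB (suc p) _ r c (swapAdj-punchIn-suc p c)))
                   (negate-left (sign p) (A 0 p) _))

  x≡-x⇒x≡0 : ∀ x → x ≡ - x → x ≡ 0ℤ
  x≡-x⇒x≡0 (+ zero)  _  = refl
  x≡-x⇒x≡0 (+ suc n) ()
  x≡-x⇒x≡0 -[1+ n ]  ()

  detℕ-equalAdjColumns : ∀ k p A → suc p < k → (∀ r → A r p ≡ A r (suc p)) → detℕ k A ≡ 0ℤ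
  detℕ-equalAdjColumns k p A 1+p<k eq = x≡-x⇒x≡0 _ (detℕ-swapAdj k p A A 1+p<k swap-invariant)
    where
    swap-invariant : ∀ r c → A r c ≡ A r (swapAdj p c)
    swap-invariant r c with swapView p c
    ... | below c<p   = cong (A r) (sym (swapAdj-< p c c<p))
    ... | above 2+p≤c = cong (A r) (sym (swapAdj-> p c 2+p≤c))
    ... | at refl     = trans (eq r) (cong (A r) (sym (swapAdj-≡ p)))
    ... | next refl   = trans (sym (eq r)) (cong (A r) (sym (swapAdj-suc p)))

  detℕ-equalColumns : ∀ k A c d → c < d → d < k → (∀ r → A r c ≡ A r d) → detℕ k A ≡ 0ℤ
  detℕ-equalColumns k A c (suc d) c<1+d 1+d<k eq with ℕₚ.m<1+n⇒m<n∨m≡n c<1+d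
  ... | inj₂ refl = detℕ-equalAdjColumns k c A 1+d<k eq
  ... | inj₁ c<d  = begin
    detℕ k A       ≡⟨ sym (ℤₚ.neg-involutive _) ⟩
    - - detℕ k A   ≡⟨ cong -_ (sym (detℕ-swapAdj k d A swapped 1+d<k (λ _ _ → refl))) ⟩
    - detℕ k swapped ≡⟨ cong -_ (detℕ-equalColumns k swapped c d c<d (ℕₚ.<-trans (ℕₚ.n<1+n d) 1+d<k) eq′) ⟩
    - 0ℤ           ∎
    where
    open ≡-Reasoning
    swapped : Mat
    swapped r x = A r (swapAdj d x)
    eq′ : ∀ r → swapped r c ≡ swapped r d
    eq′ r = trans (cong (A r) (swapAdj-< d c c<d)) (trans (eq r) (cong (A r) (sym (swapAdj-≡ d))))

  sumℕ-linear : ∀ k a b f g → sumℕ k (λ j → a * f j + b * g j) ≡ a * sumℕ k f + b * sumℕ k g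
  sumℕ-linear k a b f g =
    trans (sumℕ-+ k (λ j → a * f j) (λ j → b * g j)) (cong₂ _+_ (sumℕ-*ˡ k a f) (sumℕ-*ˡ k b g))

  detℕ-linearColumn : ∀ k c A B C a b → c < k →
    (∀ r x → x ≢ c → A r x ≡ C r x) → (∀ r x → x ≢ c → B r x ≡ C r x) →
    (∀ r → C r c ≡ a * A r c + b * B r c) → detℕ k C ≡ a * detℕ k A + b * detℕ k B
  detℕ-linearColumn (suc k) c A B C a b c<1+k A≡C B≡C Cc =
    trans (sumℕ-cong (suc k) _ _ term≡) (sumℕ-linear (suc k) a b termA termB)
    where
    termA termB : ℕ → ℤ
    termA j = sign j * A 0 j * detℕ k (minor j A)
    termB j = sign j * B 0 j * detℕ k (minor j B)
    expand-entry : ∀ a b s x y d → s * (a * x + b * y) * d ≡ a * (s * x * d) + b * (s * y * d)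
    expand-entry = solve-∀
    expand-minor : ∀ a b s x dA dB → s * x * (a * dA + b * dB) ≡ a * (s * x * dA) + b * (s * x * dB)
    expand-minor = solve-∀
    term≡ : ∀ j → j < suc k → sign j * C 0 j * detℕ k (minor j C) ≡ a * termA j + b * termB j
    term≡ j j<1+k with j ℕ.≟ c
    ... | yes refl =
      trans (cong₂ (λ x d → sign j * x * d) (Cc 0) minorC≡minorA)
            (trans (expand-entry a b (sign j) (A 0 j) (B 0 j) _)
                   (cong (λ d → a * termA j + b * (sign j * B 0 j * d)) minorA≡minorB))
      where
      minorC≡minorA : detℕ k (minor j C) ≡ detℕ k (minor j A)
      minorC≡minorA = detℕ-cong k _ _ λ r x → sym (A≡C (suc r) (punchInℕ j x) (punchInℕ≢ j x))
      minorA≡minorB : detℕ k (minor j A) ≡ detℕ k (minor j B)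
      minorA≡minorB = detℕ-cong k _ _ λ r x →
        trans (A≡C (suc r) (punchInℕ j x) (punchInℕ≢ j x)) (sym (B≡C (suc r) (punchInℕ j x) (punchInℕ≢ j x)))
    ... | no j≢c with punchOutℕ j c j≢c
    ... | c′ , refl =
      trans (cong (λ d → sign j * C 0 j * d)
              (detℕ-linearColumn k c′ (minor j A) (minor j B) (minor j C) a b
                (punchInℕ<⇒< k j c′ j<1+k c<1+k) (off A≡C) (off B≡C) (λ r → Cc (suc r))))
            (trans (expand-minor a b (sign j) (C 0 j) _ _)
                   (cong₂ (λ x y → a * (sign j * x * detℕ k (minor j A)) + b * (sign j * y * detℕ k (minor j B)))
                          (sym (A≡C 0 j j≢c)) (sym (B≡C 0 j j≢c))))
      where
      off : ∀ {D} → (∀ r x → x ≢ punchInℕ j c′ → D r x ≡ C r x) →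
            ∀ r x → x ≢ c′ → minor j D r x ≡ minor j C r x
      off D≡C r x x≢c′ = D≡C (suc r) (punchInℕ j x) (λ e → x≢c′ (punchInℕ-injective j x c′ e))

  replaceColumn : Mat → ℕ → (ℕ → ℤ) → Mat
  replaceColumn A c v r x with x ℕ.≟ c
  ... | yes _ = v r
  ... | no  _ = A r x

  replaceColumn-≡ : ∀ A c v r → replaceColumn A c v r c ≡ v r
  replaceColumn-≡ A c v r with c ℕ.≟ c
  ... | yes _   = refl
  ... | no  c≢c = ⊥-elim (c≢c refl)

  replaceColumn-≢ : ∀ A c v r x → x ≢ c → replaceColumn A c v r x ≡ A r x
  replaceColumn-≢ A c v r x x≢c with x ℕ.≟ c
  ... | yes x≡c = ⊥-elim (x≢c x≡c)
  ... | no  _   = refl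

  detℕ-scaleColumn : ∀ k c A C a → c < k → (∀ r x → x ≢ c → A r x ≡ C r x) →
    (∀ r → C r c ≡ a * A r c) → detℕ k C ≡ a * detℕ k A
  detℕ-scaleColumn k c A C a c<k A≡C Cc =
    trans (detℕ-linearColumn k c A A C a 0ℤ c<k A≡C A≡C (λ r → trans (Cc r) (pad a (A r c))))
          (unpad a (detℕ k A))
    where
    pad : ∀ a x → a * x ≡ a * x + 0ℤ * x
    pad = solve-∀
    unpad : ∀ a d → a * d + 0ℤ * d ≡ a * d
    unpad = solve-∀

  detℕ-addColumn : ∀ k c d A C t → c < k → d < k → c ≢ d →
    (∀ r x → x ≢ c → C r x ≡ A r x) → (∀ r → C r c ≡ A r c + t * A r d) → detℕ k C ≡ detℕ k A
  detℕ-addColumn k c d A C t c<k d<k c≢d C≡A Cc = begin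
    detℕ k C                          ≡⟨ detℕ-linearColumn k c A D C 1ℤ t c<k (λ r x x≢c → sym (C≡A r x x≢c)) D≡C Cc′ ⟩
    1ℤ * detℕ k A + t * detℕ k D      ≡⟨ cong (λ δ → 1ℤ * detℕ k A + t * δ) detD≡0 ⟩
    1ℤ * detℕ k A + t * 0ℤ            ≡⟨ drop (detℕ k A) t ⟩
    detℕ k A                          ∎
    where
    open ≡-Reasoning
    D : Mat
    D = replaceColumn A c (λ r → A r d)
    D≡C : ∀ r x → x ≢ c → D r x ≡ C r x
    D≡C r x x≢c = trans (replaceColumn-≢ A c _ r x x≢c) (sym (C≡A r x x≢c))
    Cc′ : ∀ r → C r c ≡ 1ℤ * A r c + t * D r c
    Cc′ r = trans (Cc r) (cong₂ (λ u v → u + t * v) (sym (ℤₚ.*-identityˡ (A r c))) (sym (replaceColumn-≡ A c _ r)))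
    Dc≡Dd : ∀ r → D r c ≡ D r d
    Dc≡Dd r = trans (replaceColumn-≡ A c _ r) (sym (replaceColumn-≢ A c _ r d (λ e → c≢d (sym e))))
    detD≡0 : detℕ k D ≡ 0ℤ
    detD≡0 with ℕₚ.<-cmp c d
    ... | tri< c<d _ _ = detℕ-equalColumns k D c d c<d d<k Dc≡Dd
    ... | tri≈ _ c≡d _ = ⊥-elim (c≢d c≡d)
    ... | tri> _ _ d<c = detℕ-equalColumns k D d c d<c c<k (λ r → sym (Dc≡Dd r))
    drop : ∀ δ t → 1ℤ * δ + t * 0ℤ ≡ δ
    drop = solve-∀

  combineInto0 : Mat → (ℕ → ℤ) → ℕ → Mat
  combineInto0 A v m r zero    = A r 0 + sumℕ m (λ t → v t * A r (suc t))
  combineInto0 A v m r (suc x) = A r (suc x)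

  detℕ-combineInto0 : ∀ k A v m → m ≤ k → detℕ (suc k) (combineInto0 A v m) ≡ detℕ (suc k) A
  detℕ-combineInto0 k A v zero    _     = detℕ-cong (suc k) _ _ unchanged
    where
    unchanged : ∀ r c → combineInto0 A v 0 r c ≡ A r c
    unchanged r zero    = ℤₚ.+-identityʳ (A r 0)
    unchanged r (suc x) = refl
  detℕ-combineInto0 k A v (suc m) 1+m≤k =
    trans (detℕ-addColumn (suc k) 0 (suc m) (combineInto0 A v m) (combineInto0 A v (suc m)) (v m)
             (s≤s z≤n) (s≤s 1+m≤k) (λ ()) off column0)
          (detℕ-combineInto0 k A v m (ℕₚ.≤-trans (ℕₚ.n≤1+n m) 1+m≤k))
    where
    off : ∀ r x → x ≢ 0 → combineInto0 A v (suc m) r x ≡ combineInto0 A v m r x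
    off r zero    x≢0 = ⊥-elim (x≢0 refl)
    off r (suc x) _   = refl
    column0 : ∀ r → combineInto0 A v (suc m) r 0 ≡ combineInto0 A v m r 0 + v m * A r (suc m)
    column0 r = trans (cong (λ s → A r 0 + s) (sumℕ-sucʳ m _)) (sym (ℤₚ.+-assoc (A r 0) _ _))

  restrict : ℕ → (ℕ → ℤ) → ℕ → ℤ
  restrict m w y with y ℕ.<? m
  ... | yes _ = w y
  ... | no  _ = 0ℤ

  restrict-< : ∀ m w y → y < m → restrict m w y ≡ w y
  restrict-< m w y y<m with y ℕ.<? m
  ... | yes _   = refl
  ... | no  y≮m = ⊥-elim (y≮m y<m)

  restrict-≥ : ∀ m w y → m ≤ y → restrict m w y ≡ 0ℤ
  restrict-≥ m w y m≤y with y ℕ.<? m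
  ... | yes y<m = ⊥-elim (ℕₚ.<⇒≱ y<m m≤y)
  ... | no  _   = refl

  restrict-suc : ∀ m w y → y ≢ m → restrict (suc m) w y ≡ restrict m w y
  restrict-suc m w y y≢m with ℕₚ.<-cmp y m
  ... | tri< y<m _ _ = trans (restrict-< (suc m) w y (ℕₚ.m<n⇒m<1+n y<m)) (sym (restrict-< m w y y<m))
  ... | tri≈ _ y≡m _ = ⊥-elim (y≢m y≡m)
  ... | tri> _ _ m<y = trans (restrict-≥ (suc m) w y m<y) (sym (restrict-≥ m w y (ℕₚ.<⇒≤ m<y)))

  spreadColumn0 : Mat → (ℕ → ℤ) → ℕ → Mat
  spreadColumn0 A w m r zero    = A r 0
  spreadColumn0 A w m r (suc y) = A r (suc y) + restrict m w y * A r 0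

  detℕ-spreadColumn0 : ∀ k A w m → m ≤ k → detℕ (suc k) (spreadColumn0 A w m) ≡ detℕ (suc k) A
  detℕ-spreadColumn0 k A w zero    _     = detℕ-cong (suc k) _ _ unchanged
    where
    unpad : ∀ a b → a + 0ℤ * b ≡ a
    unpad = solve-∀
    unchanged : ∀ r c → spreadColumn0 A w 0 r c ≡ A r c
    unchanged r zero    = refl
    unchanged r (suc y) =
      trans (cong (λ c → A r (suc y) + c * A r 0) (restrict-≥ 0 w y z≤n)) (unpad (A r (suc y)) (A r 0))
  detℕ-spreadColumn0 k A w (suc m) 1+m≤k =
    trans (detℕ-addColumn (suc k) (suc m) 0 (spreadColumn0 A w m) (spreadColumn0 A w (suc m)) (w m)
             (s≤s 1+m≤k) (s≤s z≤n) (λ ()) off columnm)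
          (detℕ-spreadColumn0 k A w m (ℕₚ.≤-trans (ℕₚ.n≤1+n m) 1+m≤k))
    where
    off : ∀ r x → x ≢ suc m → spreadColumn0 A w (suc m) r x ≡ spreadColumn0 A w m r x
    off r zero    _      = refl
    off r (suc y) y≢1+m  = cong (λ c → A r (suc y) + c * A r 0) (restrict-suc m w y (λ e → y≢1+m (cong suc e)))
    columnm : ∀ r → spreadColumn0 A w (suc m) r (suc m) ≡ spreadColumn0 A w m r (suc m) + w m * A r 0
    columnm r = begin
      A r (suc m) + restrict (suc m) w m * A r 0     ≡⟨ cong (λ c → A r (suc m) + c * A r 0) (restrict-< (suc m) w m (ℕₚ.n<1+n m)) ⟩
      A r (suc m) + w m * A r 0                       ≡⟨ regroup (A r (suc m)) (w m) (A r 0) ⟩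
      A r (suc m) + 0ℤ * A r 0 + w m * A r 0
        ≡⟨ cong (λ c → A r (suc m) + c * A r 0 + w m * A r 0) (sym (restrict-≥ m w m ℕₚ.≤-refl)) ⟩
      A r (suc m) + restrict m w m * A r 0 + w m * A r 0 ∎
      where
      open ≡-Reasoning
      regroup : ∀ a c b → a + c * b ≡ a + 0ℤ * b + c * b
      regroup = solve-∀

  detℕ-expandCorner : ∀ k M → (∀ x → x < k → M 0 (suc x) ≡ 0ℤ) → detℕ (suc k) M ≡ M 0 0 * detℕ k (minor 0 M)
  detℕ-expandCorner k M row0 =
    trans (cong (λ s → sign 0 * M 0 0 * detℕ k (minor 0 M) + s) (sumℕ-≡0 k _ vanish))
          (simplify (M 0 0) (detℕ k (minor 0 M)))
    where
    annihilate : ∀ s d → s * 0ℤ * d ≡ 0ℤ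
    annihilate = solve-∀
    vanish : ∀ j → j < k → sign (suc j) * M 0 (suc j) * detℕ k (minor (suc j) M) ≡ 0ℤ
    vanish j j<k = trans (cong (λ a → sign (suc j) * a * detℕ k (minor (suc j) M)) (row0 j j<k))
                         (annihilate (sign (suc j)) _)
    simplify : ∀ a d → 1ℤ * a * d + 0ℤ ≡ a * d
    simplify = solve-∀

  setColumn0 : Mat → (ℕ → ℤ) → Mat
  setColumn0 A u r zero    = u r
  setColumn0 A u r (suc x) = A r (suc x)

  detℕ-deflate : ∀ k (A : Mat) (w : ℕ → ℤ) s (u : ℕ → ℤ) → w 0 ≡ 1ℤ → u 0 ≡ 1ℤ →
    (∀ r → r < suc k → sumℕ (suc k) (λ t → w t * A r t) ≡ s * u r) →
    detℕ (suc k) A ≡ s * detℕ k (λ r c → A (suc r) (suc c) - A 0 (suc c) * u (suc r))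
  detℕ-deflate k A w s u w0≡1 u0≡1 eigen = begin
    detℕ (suc k) A                                    ≡⟨ sym (detℕ-combineInto0 k A (λ t → w (suc t)) k ℕₚ.≤-refl) ⟩
    detℕ (suc k) (combineInto0 A (λ t → w (suc t)) k) ≡⟨ detℕ-cong< (suc k) _ _ combined ⟩
    detℕ (suc k) (setColumn0 A (λ r → s * u r))       ≡⟨ detℕ-scaleColumn (suc k) 0 (setColumn0 A u) _ s (s≤s z≤n) off (λ _ → refl) ⟩
    s * detℕ (suc k) (setColumn0 A u)                  ≡⟨ cong (s *_) (sym (detℕ-spreadColumn0 k (setColumn0 A u) w′ k ℕₚ.≤-refl)) ⟩
    s * detℕ (suc k) S                                 ≡⟨ cong (s *_) (detℕ-expandCorner k S row0) ⟩
    s * (u 0 * detℕ k (minor 0 S))                     ≡⟨ cong (λ a → s * (a * detℕ k (minor 0 S))) u0≡1 ⟩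
    s * (1ℤ * detℕ k (minor 0 S))                      ≡⟨ cong (s *_) (ℤₚ.*-identityˡ _) ⟩
    s * detℕ k (minor 0 S)                             ≡⟨ cong (s *_) (detℕ-cong< k _ _ entries) ⟩
    s * detℕ k (λ r c → A (suc r) (suc c) - A 0 (suc c) * u (suc r)) ∎
    where
    open ≡-Reasoning
    w′ : ℕ → ℤ
    w′ y = - A 0 (suc y)
    S : Mat
    S = spreadColumn0 (setColumn0 A u) w′ k
    combined : ∀ r c → r < suc k → c < suc k → combineInto0 A (λ t → w (suc t)) k r c ≡ setColumn0 A (λ r → s * u r) r c
    combined r zero    r<1+k _ = begin
      A r 0 + sumℕ k (λ t → w (suc t) * A r (suc t))
        ≡⟨ cong (λ a → a + sumℕ k (λ t → w (suc t) * A r (suc t))) (sym (ℤₚ.*-identityˡ (A r 0))) ⟩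
      1ℤ * A r 0 + sumℕ k (λ t → w (suc t) * A r (suc t)) ≡⟨ cong (λ a → a * A r 0 + sumℕ k (λ t → w (suc t) * A r (suc t))) (sym w0≡1) ⟩
      w 0 * A r 0 + sumℕ k (λ t → w (suc t) * A r (suc t)) ≡⟨ eigen r r<1+k ⟩
      s * u r                                              ∎
    combined r (suc c) _     _ = refl
    off : ∀ r x → x ≢ 0 → setColumn0 A u r x ≡ setColumn0 A (λ r → s * u r) r x
    off r zero    x≢0 = ⊥-elim (x≢0 refl)
    off r (suc x) _   = refl
    cancel : ∀ a → a + (- a) * 1ℤ ≡ 0ℤ
    cancel = solve-∀
    row0 : ∀ x → x < k → S 0 (suc x) ≡ 0ℤ
    row0 x x<k = trans (cong₂ (λ c v → A 0 (suc x) + c * v) (restrict-< k w′ x x<k) u0≡1) (cancel (A 0 (suc x)))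
    rearrange : ∀ a b v → a + (- b) * v ≡ a - b * v
    rearrange = solve-∀
    entries : ∀ r c → r < k → c < k → minor 0 S r c ≡ A (suc r) (suc c) - A 0 (suc c) * u (suc r)
    entries r c _ c<k = trans (cong (λ a → A (suc r) (suc c) + a * u (suc r)) (restrict-< k w′ c c<k))
                              (rearrange (A (suc r) (suc c)) (A 0 (suc c)) (u (suc r)))

  detℕ-peelDiagonal : ∀ j K M d → (∀ r c → r < j → c < j ℕ.+ K → r ≢ c → M r c ≡ 0ℤ) →
    (∀ r → r < j → M r r ≡ d) → detℕ (j ℕ.+ K) M ≡ d ^ j * detℕ K (λ r c → M (j ℕ.+ r) (j ℕ.+ c))
  detℕ-peelDiagonal zero    K M d offDiag diag = sym (ℤₚ.*-identityˡ _)
  detℕ-peelDiagonal (suc j) K M d offDiag diag = begin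
    detℕ (suc j ℕ.+ K) M
      ≡⟨ detℕ-expandCorner (j ℕ.+ K) M (λ x x< → offDiag 0 (suc x) (s≤s z≤n) (s≤s x<) (λ ())) ⟩
    M 0 0 * detℕ (j ℕ.+ K) (minor 0 M)
      ≡⟨ cong₂ _*_ (diag 0 (s≤s z≤n)) (detℕ-peelDiagonal j K (minor 0 M) d offDiag′ diag′) ⟩
    d * (d ^ j * detℕ K (λ r c → M (suc j ℕ.+ r) (suc j ℕ.+ c))) ≡⟨ sym (ℤₚ.*-assoc d (d ^ j) _) ⟩
    d ^ suc j * detℕ K (λ r c → M (suc j ℕ.+ r) (suc j ℕ.+ c)) ∎
    where
    open ≡-Reasoning
    offDiag′ : ∀ r c → r < j → c < j ℕ.+ K → r ≢ c → minor 0 M r c ≡ 0ℤ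
    offDiag′ r c r<j c< r≢c = offDiag (suc r) (suc c) (s≤s r<j) (s≤s c<) (λ e → r≢c (ℕₚ.suc-injective e))
    diag′ : ∀ r → r < j → minor 0 M r r ≡ d
    diag′ r r<j = diag (suc r) (s≤s r<j)

module DihedralCSEP where

  open import Data.Nat as ℕ using (ℕ; zero; suc; _≡ᵇ_; z≤n; s≤s; _∸_; _%_; _/_; _<_; _≤_; _≟_; _<?_)
  import Data.Nat.Properties as ℕₚ
  open import Data.Nat.DivMod
  open import Data.Nat.Divisibility using (_∣_; divides)
  open import Data.Fin as Fin using (Fin; toℕ; _↑ˡ_; _↑ʳ_; splitAt)
  import Data.Fin.Properties as Finₚ
  open import Data.Bool using (Bool; true; false; not; _∧_; if_then_else_)
  open import Data.Bool.Properties using (∧-conicalˡ; ∧-conicalʳ; ¬-not)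
  import Data.Bool.Properties as Boolₚ
  open import Data.Bool.ListAction using (any)
  open import Data.List using (tabulate; applyUpTo)
  open import Data.List.Properties using (map-tabulate)
  open import Data.Sum using (_⊎_; inj₁; inj₂)
  open import Data.Product using (∃; _×_; _,_; proj₁; proj₂)
  open import Data.Empty using (⊥; ⊥-elim)
  open import Relation.Nullary using (Dec; yes; no)
  open import Relation.Nullary.Decidable using (⌊_⌋)
  open import Relation.Binary.PropositionalEquality
  open import Function.Bundles using (Equivalence)
  open import Data.Nat.Tactic.RingSolver using (solve-∀)

  any-tabulate⁺ : ∀ {A : Set} k (h : Fin k → A) (p : A → Bool) i → p (h i) ≡ true → any p (tabulate h) ≡ true
  any-tabulate⁺ (suc k) h p Fin.zero    phi rewrite phi = refl
  any-tabulate⁺ (suc k) h p (Fin.suc i) phi with p (h Fin.zero)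
  ... | true  = refl
  ... | false = any-tabulate⁺ k (λ j → h (Fin.suc j)) p i phi

  any-tabulate⁻ : ∀ {A : Set} k (h : Fin k → A) (p : A → Bool) → any p (tabulate h) ≡ true → ∃ λ i → p (h i) ≡ true
  any-tabulate⁻ (suc k) h p any≡ with p (h Fin.zero) in ph0
  ... | true  = Fin.zero , ph0
  ... | false with any-tabulate⁻ k (λ j → h (Fin.suc j)) p any≡
  ...   | i , phi = Fin.suc i , phi

  any-applyUpTo⁺ : ∀ N (f : ℕ → ℕ) (p : ℕ → Bool) k → k < N → p (f k) ≡ true → any p (applyUpTo f N) ≡ true
  any-applyUpTo⁺ (suc N) f p zero    _       pfk rewrite pfk = refl
  any-applyUpTo⁺ (suc N) f p (suc k) (s≤s k<N) pfk with p (f zero)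
  ... | true  = refl
  ... | false = any-applyUpTo⁺ N (λ j → f (suc j)) p k k<N pfk

  any-applyUpTo⁻ : ∀ N (f : ℕ → ℕ) (p : ℕ → Bool) → any p (applyUpTo f N) ≡ true → ∃ λ k → p (f k) ≡ true
  any-applyUpTo⁻ (suc N) f p any≡ with p (f zero) in pf0
  ... | true  = zero , pf0
  ... | false with any-applyUpTo⁻ N (λ j → f (suc j)) p any≡
  ...   | k , pfk = suc k , pfk

  ≡ᵇ-refl : ∀ a → (a ≡ᵇ a) ≡ true
  ≡ᵇ-refl zero    = refl
  ≡ᵇ-refl (suc a) = ≡ᵇ-refl a

  ≢⇒≡ᵇ≡false : ∀ {a b} → a ≢ b → (a ≡ᵇ b) ≡ false
  ≢⇒≡ᵇ≡false {a} {b} a≢b = ¬-not λ a≡ᵇb → a≢b (ℕₚ.≡ᵇ⇒≡ a b (Equivalence.from Boolₚ.T-≡ a≡ᵇb))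

  not-∧≡if : ∀ b c → not b ∧ c ≡ (if b then false else c)
  not-∧≡if true  c = refl
  not-∧≡if false c = refl

  module AnyOrder (m : ℕ) where
    open Dihedral m

    infix 4 _≡ₘ_
    record _≡ₘ_ (x y : ℕ) : Set where
      constructor mk
      field un : x % n ≡ y % n

    ≡ₘ-refl : ∀ {x} → x ≡ₘ x
    ≡ₘ-refl = mk refl

    ≡ₘ-sym : ∀ {x y} → x ≡ₘ y → y ≡ₘ x
    ≡ₘ-sym (mk p) = mk (sym p)

    ≡ₘ-trans : ∀ {x y z} → x ≡ₘ y → y ≡ₘ z → x ≡ₘ z
    ≡ₘ-trans (mk p) (mk p′) = mk (trans p p′)

    ≡⇒≡ₘ : ∀ {x y} → x ≡ y → x ≡ₘ y
    ≡⇒≡ₘ refl = mk refl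

    %-≡ₘ : ∀ x → x % n ≡ₘ x
    %-≡ₘ x = mk (m%n%n≡m%n x n)

    +-≡ₘ : ∀ {x x′ y y′} → x ≡ₘ x′ → y ≡ₘ y′ → x ℕ.+ y ≡ₘ x′ ℕ.+ y′
    +-≡ₘ {x} {x′} {y} {y′} (mk p) (mk p′) = mk (begin
      (x ℕ.+ y) % n              ≡⟨ %-distribˡ-+ x y n ⟩
      (x % n ℕ.+ y % n) % n      ≡⟨ cong₂ (λ u v → (u ℕ.+ v) % n) p p′ ⟩
      (x′ % n ℕ.+ y′ % n) % n    ≡⟨ %-distribˡ-+ x′ y′ n ⟨
      (x′ ℕ.+ y′) % n            ∎)
      where open ≡-Reasoning

    +n-≡ₘ : ∀ x → x ℕ.+ n ≡ₘ x
    +n-≡ₘ x = mk ([m+n]%n≡m%n x n)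

    toℕ-mod-≡ₘ : ∀ x → toℕ (x mod n) ≡ₘ x
    toℕ-mod-≡ₘ x = ≡ₘ-trans (≡⇒≡ₘ (Finₚ.toℕ-fromℕ< _)) (%-≡ₘ x)

    +F-≡ₘ : ∀ i j → toℕ (i +F j) ≡ₘ toℕ i ℕ.+ toℕ j
    +F-≡ₘ i j = toℕ-mod-≡ₘ (toℕ i ℕ.+ toℕ j)

    negF-≡ₘ : ∀ i → toℕ (negF i) ≡ₘ n ∸ toℕ i
    negF-≡ₘ i = toℕ-mod-≡ₘ (n ∸ toℕ i)

    ≡ₘ⇒≡ : ∀ (i j : Fin n) → toℕ i ≡ₘ toℕ j → i ≡ j
    ≡ₘ⇒≡ i j (mk p) = Finₚ.toℕ-injective (begin
      toℕ i       ≡⟨ m<n⇒m%n≡m (Finₚ.toℕ<n i) ⟨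
      toℕ i % n   ≡⟨ p ⟩
      toℕ j % n   ≡⟨ m<n⇒m%n≡m (Finₚ.toℕ<n j) ⟩
      toℕ j       ∎)
      where open ≡-Reasoning

    i+[n∸i]≡n : ∀ (i : Fin n) → toℕ i ℕ.+ (n ∸ toℕ i) ≡ n
    i+[n∸i]≡n i = ℕₚ.m+[n∸m]≡n (ℕₚ.<⇒≤ (Finₚ.toℕ<n i))

    +F-identityˡ : ∀ i → Fin.zero +F i ≡ i
    +F-identityˡ i = ≡ₘ⇒≡ _ _ (+F-≡ₘ Fin.zero i)

    +F-identityʳ : ∀ i → i +F Fin.zero ≡ i
    +F-identityʳ i = ≡ₘ⇒≡ _ _ (≡ₘ-trans (+F-≡ₘ i Fin.zero) (≡⇒≡ₘ (ℕₚ.+-identityʳ (toℕ i))))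

    negF-zero : negF Fin.zero ≡ Fin.zero
    negF-zero = ≡ₘ⇒≡ _ _ (≡ₘ-trans (negF-≡ₘ Fin.zero) (+n-≡ₘ 0))

    +F-inverseʳ : ∀ i → i +F negF i ≡ Fin.zero
    +F-inverseʳ i = ≡ₘ⇒≡ _ _ (≡ₘ-trans (+F-≡ₘ i (negF i))
      (≡ₘ-trans (+-≡ₘ (≡ₘ-refl {toℕ i}) (negF-≡ₘ i)) (≡ₘ-trans (≡⇒≡ₘ (i+[n∸i]≡n i)) (+n-≡ₘ 0))))

    negF-involutive : ∀ i → negF (negF i) ≡ i
    negF-involutive Fin.zero        = trans (cong negF negF-zero) negF-zero
    negF-involutive i@(Fin.suc _) = ≡ₘ⇒≡ _ _ (≡ₘ-trans (negF-≡ₘ (negF i))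
      (≡⇒≡ₘ (trans (cong (n ∸_) toℕ-negF) (ℕₚ.m∸[m∸n]≡n (ℕₚ.<⇒≤ (Finₚ.toℕ<n i))))))
      where
      toℕ-negF : toℕ (negF i) ≡ n ∸ toℕ i
      toℕ-negF = trans (Finₚ.toℕ-fromℕ< _) (m<n⇒m%n≡m (ℕₚ.∸-monoʳ-< (s≤s z≤n) (ℕₚ.<⇒≤ (Finₚ.toℕ<n i))))

    negF≡0⇒≡0 : ∀ i → negF i ≡ Fin.zero → i ≡ Fin.zero
    negF≡0⇒≡0 i negi≡0 = trans (sym (negF-involutive i)) (trans (cong negF negi≡0) negF-zero)

    open FiniteGroup group using (pow; inCyclic; elements; csepAdj)

    identity : D
    identity = (Fin.zero , false)

    conj : D → D → D
    conj g w = mul (mul g w) (invD g)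

    mul-identityˡ : ∀ w → mul identity w ≡ w
    mul-identityˡ (i , t) = cong (_, t) (+F-identityˡ i)

    mul-identityʳ : ∀ w → mul w identity ≡ w
    mul-identityʳ (i , false) = cong (_, false) (+F-identityʳ i)
    mul-identityʳ (i , true)  = cong (_, true) (trans (cong (i +F_) negF-zero) (+F-identityʳ i))

    conj-identity : ∀ w → conj identity w ≡ w
    conj-identity w = begin
      mul (mul identity w) (negF Fin.zero , false) ≡⟨ cong₂ mul (mul-identityˡ w) (cong (_, false) negF-zero) ⟩
      mul w identity                               ≡⟨ mul-identityʳ w ⟩
      w                                            ∎
      where open ≡-Reasoning

    j+x+[n∸j]≡ₘx : ∀ (j : Fin n) x → toℕ j ℕ.+ x ℕ.+ (n ∸ toℕ j) ≡ₘ x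
    j+x+[n∸j]≡ₘx j x = ≡ₘ-trans (≡⇒≡ₘ (begin
      toℕ j ℕ.+ x ℕ.+ (n ∸ toℕ j)   ≡⟨ cong (ℕ._+ (n ∸ toℕ j)) (ℕₚ.+-comm (toℕ j) x) ⟩
      x ℕ.+ toℕ j ℕ.+ (n ∸ toℕ j)   ≡⟨ ℕₚ.+-assoc x (toℕ j) _ ⟩
      x ℕ.+ (toℕ j ℕ.+ (n ∸ toℕ j)) ≡⟨ cong (x ℕ.+_) (i+[n∸i]≡n j) ⟩
      x ℕ.+ n                       ∎)) (+n-≡ₘ x)
      where open ≡-Reasoning

    conj-rotation : ∀ g β → conj g (β , false) ≡ (β , false) ⊎ conj g (β , false) ≡ (negF β , false)
    conj-rotation (j , false) β = inj₁ (cong (_, false) (≡ₘ⇒≡ _ _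
      (≡ₘ-trans (+F-≡ₘ (j +F β) (negF j)) (≡ₘ-trans (+-≡ₘ (+F-≡ₘ j β) (negF-≡ₘ j)) (j+x+[n∸j]≡ₘx j (toℕ β))))))
    conj-rotation (j , true) β = inj₂ (cong (_, false) (≡ₘ⇒≡ _ _
      (≡ₘ-trans (+F-≡ₘ (j +F negF β) (negF j))
        (≡ₘ-trans (+-≡ₘ (+F-≡ₘ j (negF β)) (negF-≡ₘ j)) (j+x+[n∸j]≡ₘx j (toℕ (negF β)))))))

    pow-rotation : ∀ ζ k → proj₂ (pow (ζ , false) k) ≡ false
    pow-rotation ζ zero    = refl
    pow-rotation ζ (suc k) with pow (ζ , false) k | pow-rotation ζ k
    ... | _ , false | _ = refl

    pow-reflection : ∀ ζ k → pow (ζ , true) k ≡ identity ⊎ pow (ζ , true) k ≡ (ζ , true)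
    pow-reflection ζ zero    = inj₁ refl
    pow-reflection ζ (suc k) with pow-reflection ζ k
    ... | inj₁ p = inj₂ (trans (cong (mul (ζ , true)) p) (mul-identityʳ (ζ , true)))
    ... | inj₂ p = inj₁ (trans (cong (mul (ζ , true)) p) (cong (_, false) (+F-inverseʳ ζ)))

    generator : D
    generator = (1 mod n , false)

    pow-generator : ∀ k → pow generator k ≡ (k mod n , false)
    pow-generator zero    = cong (_, false) (≡ₘ⇒≡ _ _ (≡ₘ-sym (toℕ-mod-≡ₘ 0)))
    pow-generator (suc k) = trans (cong (mul generator) (pow-generator k)) (cong (_, false) (≡ₘ⇒≡ _ _
      (≡ₘ-trans (+F-≡ₘ (1 mod n) (k mod n))
        (≡ₘ-trans (+-≡ₘ (toℕ-mod-≡ₘ 1) (toℕ-mod-≡ₘ k)) (≡ₘ-sym (toℕ-mod-≡ₘ (suc k)))))))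

    pow-generator-toℕ : ∀ α → pow generator (toℕ α) ≡ (α , false)
    pow-generator-toℕ α = trans (pow-generator (toℕ α)) (cong (_, false) (≡ₘ⇒≡ _ _ (toℕ-mod-≡ₘ (toℕ α))))

    eqD-refl : ∀ w → eqD w w ≡ true
    eqD-refl (i , s) with i Finₚ.≟ i | s Boolₚ.≟ s
    ... | yes _   | yes _   = refl
    ... | no  i≢i | _       = ⊥-elim (i≢i refl)
    ... | yes _   | no  s≢s = ⊥-elim (s≢s refl)

    eqD-sound : ∀ w w′ → eqD w w′ ≡ true → w ≡ w′
    eqD-sound (i , s) (k , t) eq with i Finₚ.≟ k | s Boolₚ.≟ t
    ... | yes refl | yes refl = refl

    inCyclic⁺ : ∀ z w k → k < n ℕ.+ n → pow z k ≡ w → inCyclic z w ≡ true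
    inCyclic⁺ z w k k<2n zᵏ≡w =
      any-applyUpTo⁺ (n ℕ.+ n) (λ x → x) (λ x → eqD (pow z x) w) k k<2n (subst (λ u → eqD u w ≡ true) (sym zᵏ≡w) (eqD-refl w))

    inCyclic⁻ : ∀ z w → inCyclic z w ≡ true → ∃ λ k → pow z k ≡ w
    inCyclic⁻ z w inC with any-applyUpTo⁻ (n ℕ.+ n) (λ x → x) (λ x → eqD (pow z x) w) inC
    ... | k , eq = k , eqD-sound _ _ eq

    enum-↑ˡ : ∀ α → enum (α ↑ˡ n) ≡ (α , false)
    enum-↑ˡ α rewrite Finₚ.splitAt-↑ˡ n α n = refl

    enum-↑ʳ : ∀ α → enum (n ↑ʳ α) ≡ (α , true)
    enum-↑ʳ α rewrite Finₚ.splitAt-↑ʳ n n α = refl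

    enumView : ∀ i → (∃ λ α → i ≡ α ↑ˡ n) ⊎ (∃ λ α → i ≡ n ↑ʳ α)
    enumView i with splitAt n i in eq
    ... | inj₁ α = inj₁ (α , sym (Finₚ.splitAt⁻¹-↑ˡ eq))
    ... | inj₂ α = inj₂ (α , sym (Finₚ.splitAt⁻¹-↑ʳ eq))

    enum-surjective : ∀ w → ∃ λ i → enum i ≡ w
    enum-surjective (α , false) = α ↑ˡ n , enum-↑ˡ α
    enum-surjective (α , true)  = n ↑ʳ α , enum-↑ʳ α

    enum-injective : ∀ i j → enum i ≡ enum j → i ≡ j
    enum-injective i j eq with enumView i | enumView j
    ... | inj₁ (α , refl) | inj₁ (β , refl) =
      cong (_↑ˡ n) (cong proj₁ (trans (sym (enum-↑ˡ α)) (trans eq (enum-↑ˡ β))))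
    ... | inj₂ (α , refl) | inj₂ (β , refl) =
      cong (n ↑ʳ_) (cong proj₁ (trans (sym (enum-↑ʳ α)) (trans eq (enum-↑ʳ β))))
    ... | inj₁ (α , refl) | inj₂ (β , refl) with () ← cong proj₂ (trans (sym (enum-↑ˡ α)) (trans eq (enum-↑ʳ β)))
    ... | inj₂ (α , refl) | inj₁ (β , refl) with () ← cong proj₂ (trans (sym (enum-↑ʳ α)) (trans eq (enum-↑ˡ β)))

    any-elements⁺ : ∀ (P : D → Bool) w → P w ≡ true → any P elements ≡ true
    any-elements⁺ P w Pw with enum-surjective w
    ... | i , refl = subst (λ l → any P l ≡ true) (sym (map-tabulate (λ x → x) enum))
                           (any-tabulate⁺ (n ℕ.+ n) enum P i Pw)

    any-elements⁻ : ∀ (P : D → Bool) → any P elements ≡ true → ∃ λ w → P w ≡ true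
    any-elements⁻ P anyP with any-tabulate⁻ (n ℕ.+ n) enum P (subst (λ l → any P l ≡ true) (map-tabulate (λ x → x) enum) anyP)
    ... | i , Pi = enum i , Pi

    sharesCyclic? : D → D → Bool
    sharesCyclic? x y = any (λ z → any (λ g → any (λ h →
      inCyclic z (conj g x) ∧ inCyclic z (conj h y)) elements) elements) elements

    csepAdj≡ : ∀ x y → csepAdj x y ≡ not (eqD x y) ∧ sharesCyclic? x y
    csepAdj≡ x y = refl

    SharesCyclic : D → D → Set
    SharesCyclic x y = ∃ λ z → ∃ λ g → ∃ λ h → (∃ λ k → pow z k ≡ conj g x) × (∃ λ k → pow z k ≡ conj h y)

    sharesCyclic?⁺ : ∀ x y z g h k k′ → k < n ℕ.+ n → k′ < n ℕ.+ n →
      pow z k ≡ conj g x → pow z k′ ≡ conj h y → sharesCyclic? x y ≡ true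
    sharesCyclic?⁺ x y z g h k k′ k< k′< zᵏ zᵏ′ =
      any-elements⁺ _ z (any-elements⁺ _ g (any-elements⁺ _ h
        (cong₂ _∧_ (inCyclic⁺ z _ k k< zᵏ) (inCyclic⁺ z _ k′ k′< zᵏ′))))

    sharesCyclic?⁻ : ∀ x y → sharesCyclic? x y ≡ true → SharesCyclic x y
    sharesCyclic?⁻ x y shares with any-elements⁻ _ shares
    ... | z , zP with any-elements⁻ _ zP
    ... | g , gP with any-elements⁻ _ gP
    ... | h , hP = z , g , h , inCyclic⁻ z _ (∧-conicalˡ _ _ hP) , inCyclic⁻ z _ (∧-conicalʳ _ _ hP)

    0<2n : 0 < n ℕ.+ n
    0<2n = s≤s z≤n

    1<2n : 1 < n ℕ.+ n
    1<2n = s≤s (ℕₚ.≤-trans (s≤s z≤n) (ℕₚ.m≤n+m n m))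

    sharesCyclic-identityˡ : ∀ y → sharesCyclic? identity y ≡ true
    sharesCyclic-identityˡ y =
      sharesCyclic?⁺ identity y y identity identity 0 1 0<2n 1<2n (sym (conj-identity identity))
        (trans (mul-identityʳ y) (sym (conj-identity y)))

    sharesCyclic-identityʳ : ∀ x → sharesCyclic? x identity ≡ true
    sharesCyclic-identityʳ x =
      sharesCyclic?⁺ x identity x identity identity 1 0 1<2n 0<2n
        (trans (mul-identityʳ x) (sym (conj-identity x))) (sym (conj-identity identity))

    sharesCyclic-rotations : ∀ α β → sharesCyclic? (α , false) (β , false) ≡ true
    sharesCyclic-rotations α β =
      sharesCyclic?⁺ _ _ generator identity identity (toℕ α) (toℕ β) (toℕ<2n α) (toℕ<2n β)
        (trans (pow-generator-toℕ α) (sym (conj-identity _))) (trans (pow-generator-toℕ β) (sym (conj-identity _)))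
      where
      toℕ<2n : ∀ (γ : Fin n) → toℕ γ < n ℕ.+ n
      toℕ<2n γ = ℕₚ.<-≤-trans (Finₚ.toℕ<n γ) (ℕₚ.m≤m+n n n)

    conj-reflection-isReflection : ∀ g β → proj₂ (conj g (β , true)) ≡ true
    conj-reflection-isReflection (j , false) β = refl
    conj-reflection-isReflection (j , true)  β = refl

    pow≡reflection : ∀ z k w → pow z k ≡ w → proj₂ w ≡ true → ∃ λ ζ → z ≡ (ζ , true) × w ≡ (ζ , true)
    pow≡reflection (ζ , false) k w zᵏ≡w w-refl with () ← trans (sym (pow-rotation ζ k)) (trans (cong proj₂ zᵏ≡w) w-refl)
    pow≡reflection (ζ , true)  k w zᵏ≡w w-refl with pow-reflection ζ k
    ... | inj₁ zᵏ≡e with () ← trans (sym (cong proj₂ zᵏ≡e)) (trans (cong proj₂ zᵏ≡w) w-refl)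
    ... | inj₂ zᵏ≡z = ζ , refl , trans (sym zᵏ≡w) zᵏ≡z

    pow-reflection≢conj-rotation : ∀ α → toℕ α ≢ 0 → ∀ ζ k g → pow (ζ , true) k ≢ conj g (α , false)
    pow-reflection≢conj-rotation α α≢0 ζ k g zᵏ≡ with pow-reflection ζ k | conj-rotation g α
    ... | inj₂ zᵏ≡z | inj₁ c≡α  with () ← cong proj₂ (trans (sym zᵏ≡z) (trans zᵏ≡ c≡α))
    ... | inj₂ zᵏ≡z | inj₂ c≡-α with () ← cong proj₂ (trans (sym zᵏ≡z) (trans zᵏ≡ c≡-α))
    ... | inj₁ zᵏ≡e | inj₁ c≡α  = α≢0 (cong toℕ (sym (cong proj₁ (trans (sym zᵏ≡e) (trans zᵏ≡ c≡α)))))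
    ... | inj₁ zᵏ≡e | inj₂ c≡-α = α≢0 (cong toℕ (negF≡0⇒≡0 α (sym (cong proj₁ (trans (sym zᵏ≡e) (trans zᵏ≡ c≡-α))))))

    sharesCyclic-rotation-reflection : ∀ α β → toℕ α ≢ 0 → sharesCyclic? (α , false) (β , true) ≡ false
    sharesCyclic-rotation-reflection α β α≢0 = ¬-not λ shares → unshared (sharesCyclic?⁻ _ _ shares)
      where
      unshared : SharesCyclic (α , false) (β , true) → ⊥
      unshared (z , g , h , (k , zᵏ) , (k′ , zᵏ′))
        with pow≡reflection z k′ _ zᵏ′ (conj-reflection-isReflection h β)
      ... | ζ , refl , _ = pow-reflection≢conj-rotation α α≢0 ζ k g zᵏ

    sharesCyclic-reflection-rotation : ∀ α β → toℕ β ≢ 0 → sharesCyclic? (α , true) (β , false) ≡ false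
    sharesCyclic-reflection-rotation α β β≢0 = ¬-not λ shares → unshared (sharesCyclic?⁻ _ _ shares)
      where
      unshared : SharesCyclic (α , true) (β , false) → ⊥
      unshared (z , g , h , (k , zᵏ) , (k′ , zᵏ′))
        with pow≡reflection z k _ zᵏ (conj-reflection-isReflection g α)
      ... | ζ , refl , _ = pow-reflection≢conj-rotation β β≢0 ζ k′ h zᵏ′

  data Kind : Set where
    identityKind rotationKind : Kind
    reflectionKind : ℕ → Kind

  linked : Kind → Kind → Bool
  linked identityKind       _                  = true
  linked rotationKind       identityKind       = true
  linked rotationKind       rotationKind       = true
  linked rotationKind       (reflectionKind _) = false
  linked (reflectionKind _) identityKind       = true
  linked (reflectionKind _) rotationKind       = false
  linked (reflectionKind a) (reflectionKind b) = ⌊ a ≟ b ⌋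

  parity : ℕ → ℕ
  parity zero          = 0
  parity (suc zero)    = 1
  parity (suc (suc t)) = parity t

  parity≡%2 : ∀ t → parity t ≡ t % 2
  parity≡%2 zero          = refl
  parity≡%2 (suc zero)    = refl
  parity≡%2 (suc (suc t)) = sym (trans (cong (_% 2) (ℕₚ.+-comm 2 t)) (trans ([m+n]%n≡m%n t 2) (sym (parity≡%2 t))))

  parity-+*2 : ∀ q a → parity (q ℕ.* 2 ℕ.+ a) ≡ parity a
  parity-+*2 zero    a = refl
  parity-+*2 (suc q) a = parity-+*2 q a

  %2-+*2 : ∀ a k → (a ℕ.+ k ℕ.* 2) % 2 ≡ a % 2
  %2-+*2 a k = [m+kn]%n≡m%n a k 2

  +≡*2⇒%2≡ : ∀ a b c → a ℕ.+ b ≡ c ℕ.* 2 → a % 2 ≡ b % 2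
  +≡*2⇒%2≡ a b c a+b≡2c = begin
    a % 2                       ≡⟨ %2-+*2 a b ⟨
    (a ℕ.+ b ℕ.* 2) % 2         ≡⟨ cong (_% 2) a+2b≡b+2c ⟩
    (b ℕ.+ c ℕ.* 2) % 2         ≡⟨ %2-+*2 b c ⟩
    b % 2                       ∎
    where
    open ≡-Reasoning
    regroup : ∀ a b → a ℕ.+ b ℕ.* 2 ≡ (a ℕ.+ b) ℕ.+ b
    regroup = solve-∀
    a+2b≡b+2c : a ℕ.+ b ℕ.* 2 ≡ b ℕ.+ c ℕ.* 2
    a+2b≡b+2c = trans (regroup a b) (trans (cong (ℕ._+ b) a+b≡2c) (ℕₚ.+-comm (c ℕ.* 2) b))

  module EvenOrder (m q : ℕ) (n≡2q : suc m ≡ q ℕ.* 2) where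
    open Dihedral m
    open FiniteGroup group using (csepAdj)
    open AnyOrder m

    2∣n : 2 ∣ n
    2∣n = divides q n≡2q

    ≡ₘ⇒%2≡ : ∀ {x y} → x ≡ₘ y → x % 2 ≡ y % 2
    ≡ₘ⇒%2≡ {x} {y} (mk x≡y) =
      trans (sym (m∣n⇒o%n%m≡o%m 2 n x 2∣n)) (trans (cong (_% 2) x≡y) (m∣n⇒o%n%m≡o%m 2 n y 2∣n))

    j+x+j≡x+j*2 : ∀ j x → j ℕ.+ x ℕ.+ j ≡ x ℕ.+ j ℕ.* 2
    j+x+j≡x+j*2 = solve-∀

    [j+x+j]%2≡x%2 : ∀ j x → (j ℕ.+ x ℕ.+ j) % 2 ≡ x % 2
    [j+x+j]%2≡x%2 j x = trans (cong (_% 2) (j+x+j≡x+j*2 j x)) (%2-+*2 x j)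

    conj-reflection-%2 : ∀ g β → toℕ (proj₁ (conj g (β , true))) % 2 ≡ toℕ β % 2
    conj-reflection-%2 (j , false) β = trans (≡ₘ⇒%2≡ conj≡ₘ) ([j+x+j]%2≡x%2 (toℕ j) (toℕ β))
      where
      conj≡ₘ : toℕ ((j +F β) +F negF (negF j)) ≡ₘ toℕ j ℕ.+ toℕ β ℕ.+ toℕ j
      conj≡ₘ = ≡ₘ-trans (+F-≡ₘ (j +F β) _) (+-≡ₘ (+F-≡ₘ j β) (≡⇒≡ₘ (cong toℕ (negF-involutive j))))
    conj-reflection-%2 (j , true) β =
      trans (≡ₘ⇒%2≡ conj≡ₘ) (trans ([j+x+j]%2≡x%2 (toℕ j) (n ∸ toℕ β)) [n∸β]%2≡β%2)
      where
      conj≡ₘ : toℕ ((j +F negF β) +F j) ≡ₘ toℕ j ℕ.+ (n ∸ toℕ β) ℕ.+ toℕ j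
      conj≡ₘ = ≡ₘ-trans (+F-≡ₘ (j +F negF β) j)
        (+-≡ₘ (≡ₘ-trans (+F-≡ₘ j (negF β)) (+-≡ₘ (≡ₘ-refl {toℕ j}) (negF-≡ₘ β))) (≡ₘ-refl {toℕ j}))
      [n∸β]%2≡β%2 : (n ∸ toℕ β) % 2 ≡ toℕ β % 2
      [n∸β]%2≡β%2 = +≡*2⇒%2≡ (n ∸ toℕ β) (toℕ β) q (trans (ℕₚ.m∸n+n≡m (ℕₚ.<⇒≤ (Finₚ.toℕ<n β))) n≡2q)

    half<q : ∀ x → x < n → x / 2 < q
    half<q x x<n = ℕₚ.*-cancelʳ-< 2 (x / 2) q (ℕₚ.≤-<-trans (m/n*n≤m x 2) (subst (x <_) n≡2q x<n))

    -- a and b have the same remainder mod 2, so a + 2t = b + n for t = q + b/2 − a/2, which is < n since a/2, b/2 < q.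
    reflection-shift : ∀ a b → a % 2 ≡ b % 2 → a < n → b < n → ∃ λ t → t < n × a ℕ.+ t ℕ.* 2 ≡ b ℕ.+ n
    reflection-shift a b a≡b a<n b<n = t , t<n , (begin
      a ℕ.+ t ℕ.* 2                           ≡⟨ cong (ℕ._+ t ℕ.* 2) (m≡m%n+[m/n]*n a 2) ⟩
      a % 2 ℕ.+ a / 2 ℕ.* 2 ℕ.+ t ℕ.* 2       ≡⟨ regroup (a % 2) (a / 2) t ⟩
      a % 2 ℕ.+ (a / 2 ℕ.+ t) ℕ.* 2           ≡⟨ cong₂ (λ r s → r ℕ.+ s ℕ.* 2) a≡b (ℕₚ.m+[n∸m]≡n a/2≤) ⟩
      b % 2 ℕ.+ (q ℕ.+ b / 2) ℕ.* 2           ≡⟨ distribute (b % 2) q (b / 2) ⟩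
      b % 2 ℕ.+ b / 2 ℕ.* 2 ℕ.+ q ℕ.* 2       ≡⟨ cong₂ ℕ._+_ (m≡m%n+[m/n]*n b 2) n≡2q ⟨
      b ℕ.+ n                                 ∎)
      where
      open ≡-Reasoning
      t : ℕ
      t = q ℕ.+ b / 2 ∸ a / 2
      a/2≤ : a / 2 ≤ q ℕ.+ b / 2
      a/2≤ = ℕₚ.≤-trans (ℕₚ.<⇒≤ (half<q a a<n)) (ℕₚ.m≤m+n q (b / 2))
      t<n : t < n
      t<n = subst (t <_) (sym (trans n≡2q (double q)))
              (ℕₚ.≤-<-trans (ℕₚ.m∸n≤m (q ℕ.+ b / 2) (a / 2)) (ℕₚ.+-monoʳ-< q (half<q b b<n)))
        where
        double : ∀ q → q ℕ.* 2 ≡ q ℕ.+ q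
        double = solve-∀
      regroup : ∀ r x y → r ℕ.+ x ℕ.* 2 ℕ.+ y ℕ.* 2 ≡ r ℕ.+ (x ℕ.+ y) ℕ.* 2
      regroup = solve-∀
      distribute : ∀ r x y → r ℕ.+ (x ℕ.+ y) ℕ.* 2 ≡ r ℕ.+ y ℕ.* 2 ℕ.+ x ℕ.* 2
      distribute = solve-∀

    conj-reflections : ∀ α β → toℕ α % 2 ≡ toℕ β % 2 → ∃ λ j → conj (j , false) (α , true) ≡ (β , true)
    conj-reflections α β α≡β with reflection-shift (toℕ α) (toℕ β) α≡β (Finₚ.toℕ<n α) (Finₚ.toℕ<n β)
    ... | t , t<n , α+2t≡β+n = j , cong (_, true) (≡ₘ⇒≡ _ _ (α+2j≡ₘβ))
      where
      j : Fin n
      j = Fin.fromℕ< t<n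
      α+2j≡ₘβ : toℕ ((j +F α) +F negF (negF j)) ≡ₘ toℕ β
      α+2j≡ₘβ = ≡ₘ-trans (+F-≡ₘ (j +F α) _) (≡ₘ-trans (+-≡ₘ (+F-≡ₘ j α) (≡⇒≡ₘ (cong toℕ (negF-involutive j))))
        (≡ₘ-trans (≡⇒≡ₘ (trans (cong (λ x → x ℕ.+ toℕ α ℕ.+ x) (Finₚ.toℕ-fromℕ< t<n))
                               (trans (j+x+j≡x+j*2 t (toℕ α)) α+2t≡β+n)))
                  (+n-≡ₘ (toℕ β))))

    sharesCyclic-reflections : ∀ α β → sharesCyclic? (α , true) (β , true) ≡ ⌊ parity (toℕ α) ≟ parity (toℕ β) ⌋
    sharesCyclic-reflections α β =
      trans (decide (toℕ α % 2 ≟ toℕ β % 2)) (cong₂ (λ a b → ⌊ a ≟ b ⌋) (sym (parity≡%2 (toℕ α))) (sym (parity≡%2 (toℕ β))))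
      where
      same-parity : SharesCyclic (α , true) (β , true) → toℕ α % 2 ≡ toℕ β % 2
      same-parity (z , g , h , (k , zᵏ) , (k′ , zᵏ′))
        with pow≡reflection z k _ zᵏ (conj-reflection-isReflection g α)
           | pow≡reflection z k′ _ zᵏ′ (conj-reflection-isReflection h β)
      ... | ζ , refl , cg≡ζ | _ , refl , ch≡ζ = begin
        toℕ α % 2                           ≡⟨ conj-reflection-%2 g α ⟨
        toℕ (proj₁ (conj g (α , true))) % 2 ≡⟨ cong (λ w → toℕ (proj₁ w) % 2) (trans cg≡ζ (sym ch≡ζ)) ⟩
        toℕ (proj₁ (conj h (β , true))) % 2 ≡⟨ conj-reflection-%2 h β ⟩
        toℕ β % 2                           ∎
        where open ≡-Reasoning
      conjugate⇒shares : (∃ λ j → conj (j , false) (α , true) ≡ (β , true)) → sharesCyclic? (α , true) (β , true) ≡ true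
      conjugate⇒shares (j , conj≡β) = sharesCyclic?⁺ (α , true) (β , true) (β , true) (j , false) identity 1 1 1<2n 1<2n
        (trans (mul-identityʳ (β , true)) (sym conj≡β)) (trans (mul-identityʳ (β , true)) (sym (conj-identity (β , true))))
      decide : (d : Dec (toℕ α % 2 ≡ toℕ β % 2)) → sharesCyclic? (α , true) (β , true) ≡ ⌊ d ⌋
      decide (yes α≡β) = conjugate⇒shares (conj-reflections α β α≡β)
      decide (no α≢β)  = ¬-not λ shares → α≢β (same-parity (sharesCyclic?⁻ (α , true) (β , true) shares))

    kind : D → Kind
    kind (α , false) with toℕ α ≟ 0
    ... | yes _ = identityKind
    ... | no  _ = rotationKind
    kind (α , true) = reflectionKind (parity (toℕ α))

    kind-rotation : ∀ α → (α ≡ Fin.zero × kind (α , false) ≡ identityKind) ⊎ (toℕ α ≢ 0 × kind (α , false) ≡ rotationKind)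
    kind-rotation α with toℕ α ≟ 0
    ... | yes α≡0 = inj₁ (Finₚ.toℕ-injective α≡0 , refl)
    ... | no  α≢0 = inj₂ (α≢0 , refl)

    sharesCyclic?≡linked : ∀ x y → sharesCyclic? x y ≡ linked (kind x) (kind y)
    sharesCyclic?≡linked (α , false) y with kind-rotation α
    ... | inj₁ (refl , kα) = trans (sharesCyclic-identityˡ y) (cong (λ k → linked k (kind y)) (sym kα))
    ... | inj₂ (α≢0 , kα) = trans (with-rotation y) (cong (λ k → linked k (kind y)) (sym kα))
      where
      with-rotation : ∀ y → sharesCyclic? (α , false) y ≡ linked rotationKind (kind y)
      with-rotation (β , true)  = sharesCyclic-rotation-reflection α β α≢0
      with-rotation (β , false) with kind-rotation β
      ... | inj₁ (refl , kβ) = trans (sharesCyclic-identityʳ _) (cong (linked rotationKind) (sym kβ))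
      ... | inj₂ (_ , kβ)    = trans (sharesCyclic-rotations α β) (cong (linked rotationKind) (sym kβ))
    sharesCyclic?≡linked (α , true) (β , false) with kind-rotation β
    ... | inj₁ (refl , kβ) = trans (sharesCyclic-identityʳ _) (cong (linked (kind (α , true))) (sym kβ))
    ... | inj₂ (β≢0 , kβ)  = trans (sharesCyclic-reflection-rotation α β β≢0) (cong (linked (kind (α , true))) (sym kβ))
    sharesCyclic?≡linked (α , true) (β , true) = sharesCyclic-reflections α β

    -- Index t of laplacianCSEP encodes e for t = 0, aᵗ for 0 < t < n and a^(t−n)b for n ≤ t.
    kindℕ : ℕ → Kind
    kindℕ t with t ≟ 0
    ... | yes _ = identityKind
    ... | no  _ with t <? n
    ...   | yes _ = rotationKind
    ...   | no  _ = reflectionKind (parity t)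

    kindℕ-rotation : ∀ t → t ≢ 0 → t < n → kindℕ t ≡ rotationKind
    kindℕ-rotation t t≢0 t<n with t ≟ 0
    ... | yes t≡0 = ⊥-elim (t≢0 t≡0)
    ... | no  _ with t <? n
    ...   | yes _   = refl
    ...   | no  t≮n = ⊥-elim (t≮n t<n)

    kindℕ-reflection : ∀ t → n ≤ t → kindℕ t ≡ reflectionKind (parity t)
    kindℕ-reflection t n≤t with t ≟ 0
    ... | yes refl = ⊥-elim (ℕₚ.<⇒≱ (s≤s z≤n) n≤t)
    ... | no  _ with t <? n
    ...   | yes t<n = ⊥-elim (ℕₚ.<⇒≱ t<n n≤t)
    ...   | no  _   = refl

    parity-n+ : ∀ r → parity (n ℕ.+ r) ≡ parity r
    parity-n+ r = trans (cong (λ k → parity (k ℕ.+ r)) n≡2q) (parity-+*2 q r)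

    kind-enum : ∀ i → kind (enum i) ≡ kindℕ (toℕ i)
    kind-enum i with enumView i
    ... | inj₁ (α , refl) = trans (cong kind (enum-↑ˡ α)) (trans (rotation-kind α) (cong kindℕ (sym (Finₚ.toℕ-↑ˡ α n))))
      where
      rotation-kind : ∀ α → kind (α , false) ≡ kindℕ (toℕ α)
      rotation-kind α with kind-rotation α
      ... | inj₁ (refl , kα) = kα
      ... | inj₂ (α≢0 , kα)  = trans kα (sym (kindℕ-rotation (toℕ α) α≢0 (Finₚ.toℕ<n α)))
    ... | inj₂ (α , refl) = trans (cong kind (enum-↑ʳ α)) (trans (cong reflectionKind (sym (parity-n+ (toℕ α))))
      (trans (sym (kindℕ-reflection (n ℕ.+ toℕ α) (ℕₚ.m≤m+n n (toℕ α)))) (cong kindℕ (sym (Finₚ.toℕ-↑ʳ n α)))))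

    eqD-enum : ∀ i j → eqD (enum i) (enum j) ≡ (toℕ i ≡ᵇ toℕ j)
    eqD-enum i j with toℕ i ≟ toℕ j
    ... | yes i≡j rewrite Finₚ.toℕ-injective i≡j = trans (eqD-refl (enum j)) (sym (≡ᵇ-refl (toℕ j)))
    ... | no  i≢j = trans (¬-not λ eq → i≢j (cong toℕ (enum-injective i j (eqD-sound _ _ eq)))) (sym (≢⇒≡ᵇ≡false i≢j))

    adjℕ : ℕ → ℕ → Bool
    adjℕ s t = if s ≡ᵇ t then false else linked (kindℕ s) (kindℕ t)

    csepAdj-enum : ∀ i j → csepAdj (enum i) (enum j) ≡ adjℕ (toℕ i) (toℕ j)
    csepAdj-enum i j = trans (csepAdj≡ (enum i) (enum j))
      (trans (cong₂ (λ b c → not b ∧ c) (eqD-enum i j) (trans (sharesCyclic?≡linked (enum i) (enum j)) (cong₂ linked (kind-enum i) (kind-enum j))))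
             (not-∧≡if (toℕ i ≡ᵇ toℕ j) (linked (kindℕ (toℕ i)) (kindℕ (toℕ j)))))

module CharacteristicPolynomial where

  open Determinant
  open DihedralCSEP
  open import Data.Nat as ℕ using (ℕ; zero; suc; z≤n; s≤s; _<_; _≤_; _≡ᵇ_)
  import Data.Nat.Properties as ℕₚ
  open import Data.Integer using (ℤ; +_; -_; _+_; _-_; _*_; _^_; 0ℤ; 1ℤ)
  import Data.Integer.Properties as ℤₚ
  open import Data.Integer.Tactic.RingSolver using (solve-∀)
  open import Data.Sum using (_⊎_; inj₁; inj₂)
  open import Data.Bool using (Bool; true; false; if_then_else_)
  open import Data.Fin using (Fin; toℕ)
  import Data.Fin.Properties as Finₚ
  open import Relation.Nullary using (yes; no)
  open import Relation.Nullary.Decidable using (⌊_⌋)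
  open import Relation.Binary.PropositionalEquality

  δ : ℕ → ℕ → ℤ
  δ a b = b2ℤ (a ≡ᵇ b)

  δ-refl : ∀ a → δ a a ≡ 1ℤ
  δ-refl a = cong b2ℤ (≡ᵇ-refl a)

  δ-≢ : ∀ {a b} → a ≢ b → δ a b ≡ 0ℤ
  δ-≢ a≢b = cong b2ℤ (≢⇒≡ᵇ≡false a≢b)

  sumℕ-δ : ∀ k r (g : ℕ → ℤ) → r < k → sumℕ k (λ t → δ r t * g t) ≡ g r
  sumℕ-δ (suc k) zero    g _ =
    trans (cong (λ s → 1ℤ * g 0 + s) (sumℕ-≡0 k _ λ t _ → ℤₚ.*-zeroˡ (g (suc t))))
          (trans (ℤₚ.+-identityʳ _) (ℤₚ.*-identityˡ (g 0)))
  sumℕ-δ (suc k) (suc r) g (s≤s r<k) =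
    trans (cong (_+ sumℕ k (λ t → δ r t * g (suc t))) (ℤₚ.*-zeroˡ (g 0)))
          (trans (ℤₚ.+-identityˡ _) (sumℕ-δ k r (λ t → g (suc t)) r<k))

  sumℕ-δ′ : ∀ k r → r < k → sumℕ k (δ r) ≡ 1ℤ
  sumℕ-δ′ k r r<k =
    trans (sumℕ-cong k (δ r) (λ t → δ r t * 1ℤ) (λ t _ → sym (ℤₚ.*-identityʳ (δ r t)))) (sumℕ-δ k r (λ _ → 1ℤ) r<k)

  sumℕ-parity : ∀ q (h : ℕ → ℤ) → sumℕ (q ℕ.* 2) (λ t → h (parity t)) ≡ + q * (h 0 + h 1)
  sumℕ-parity zero    h = refl
  sumℕ-parity (suc q) h =
    trans (sym (ℤₚ.+-assoc (h 0) (h 1) _))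
          (trans (cong (λ s → h 0 + h 1 + s) (sumℕ-parity q h)) (factor (+ q) (h 0 + h 1)))
    where
    factor : ∀ Q H → H + Q * H ≡ (1ℤ + Q) * H
    factor = solve-∀

  parity≡0⊎1 : ∀ t → parity t ≡ 0 ⊎ parity t ≡ 1
  parity≡0⊎1 zero          = inj₁ refl
  parity≡0⊎1 (suc zero)    = inj₂ refl
  parity≡0⊎1 (suc (suc t)) = parity≡0⊎1 t

  δ-parity-suc-1 : ∀ t → δ (parity (suc t)) 1 ≡ δ (parity t) 0
  δ-parity-suc-1 zero          = refl
  δ-parity-suc-1 (suc zero)    = refl
  δ-parity-suc-1 (suc (suc t)) = δ-parity-suc-1 t

  δ-parity-suc-0 : ∀ t → δ (parity (suc t)) 0 ≡ δ (parity t) 1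
  δ-parity-suc-0 zero          = refl
  δ-parity-suc-0 (suc zero)    = refl
  δ-parity-suc-0 (suc (suc t)) = δ-parity-suc-0 t

  δ-parity-0+1 : ∀ t → δ (parity t) 0 + δ (parity t) 1 ≡ 1ℤ
  δ-parity-0+1 t with parity≡0⊎1 t
  ... | inj₁ p rewrite p = refl
  ... | inj₂ p rewrite p = refl

  parityBlock : ℤ → Mat
  parityBlock X r c = δ r c * X + δ (parity r) (parity c)

  module ParityBlock (m′ q : ℕ) (n≡2q : suc (suc m′) ≡ q ℕ.* 2) (X : ℤ) where

    n : ℕ
    n = suc (suc m′)

    evenIndicator : ℕ → ℤ
    evenIndicator t = δ (parity t) 0

    eigenvalue : ℤ
    eigenvalue = X + + q

    parity-count : ∀ ε p → ε ≡ 0 ⊎ ε ≡ 1 → p ≡ 0 ⊎ p ≡ 1 → δ 0 ε * δ p 0 + δ 1 ε * δ p 1 ≡ δ p ε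
    parity-count .0 .0 (inj₁ refl) (inj₁ refl) = refl
    parity-count .0 .1 (inj₁ refl) (inj₂ refl) = refl
    parity-count .1 .0 (inj₂ refl) (inj₁ refl) = refl
    parity-count .1 .1 (inj₂ refl) (inj₂ refl) = refl

    parityIndicator-eigen : ∀ ε → ε ≡ 0 ⊎ ε ≡ 1 → ∀ r → r < n →
      sumℕ n (λ t → δ (parity t) ε * parityBlock X r t) ≡ δ (parity r) ε * eigenvalue
    parityIndicator-eigen ε ε01 r r<n = begin
      sumℕ n (λ t → δ (parity t) ε * parityBlock X r t)
        ≡⟨ sumℕ-cong n _ _ (λ t _ → split (δ (parity t) ε) (δ r t) X (δ (parity r) (parity t))) ⟩
      sumℕ n (λ t → δ r t * (δ (parity t) ε * X) + δ (parity t) ε * δ (parity r) (parity t))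
        ≡⟨ sumℕ-+ n (λ t → δ r t * (δ (parity t) ε * X)) (λ t → δ (parity t) ε * δ (parity r) (parity t)) ⟩
      sumℕ n (λ t → δ r t * (δ (parity t) ε * X)) + sumℕ n (λ t → δ (parity t) ε * δ (parity r) (parity t))
        ≡⟨ cong₂ _+_ (sumℕ-δ n r (λ t → δ (parity t) ε * X) r<n)
                     (trans (cong (λ k → sumℕ k (λ t → δ (parity t) ε * δ (parity r) (parity t))) n≡2q) (sumℕ-parity q (λ p → δ p ε * δ (parity r) p))) ⟩
      δ (parity r) ε * X + + q * (δ 0 ε * δ (parity r) 0 + δ 1 ε * δ (parity r) 1)
        ≡⟨ cong (λ s → δ (parity r) ε * X + + q * s) (parity-count ε (parity r) ε01 (parity≡0⊎1 r)) ⟩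
      δ (parity r) ε * X + + q * δ (parity r) ε
        ≡⟨ collect (δ (parity r) ε) X (+ q) ⟩
      δ (parity r) ε * eigenvalue ∎
      where
      open ≡-Reasoning
      split : ∀ v a X b → v * (a * X + b) ≡ a * (v * X) + v * b
      split = solve-∀
      collect : ∀ e X Q → e * X + Q * e ≡ e * (X + Q)
      collect = solve-∀

    block₁ : Mat
    block₁ r c = parityBlock X (suc r) (suc c) - parityBlock X 0 (suc c) * evenIndicator (suc r)

    deflate-even : detℕ n (parityBlock X) ≡ eigenvalue * detℕ (suc m′) block₁
    deflate-even = detℕ-deflate (suc m′) (parityBlock X) evenIndicator eigenvalue evenIndicator refl refl
      λ r r<n → trans (parityIndicator-eigen 0 (inj₁ refl) r r<n) (ℤₚ.*-comm (evenIndicator r) eigenvalue)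

    parityBlock-row0 : ∀ t → parityBlock X 0 (suc t) ≡ δ 0 (parity (suc t))
    parityBlock-row0 t = trans (cong (_+ δ 0 (parity (suc t))) (ℤₚ.*-zeroˡ X)) (ℤₚ.+-identityˡ _)

    even-odd-disjoint : ∀ t → δ (parity t) 0 * δ 0 (parity (suc t)) ≡ 0ℤ
    even-odd-disjoint zero          = refl
    even-odd-disjoint (suc zero)    = refl
    even-odd-disjoint (suc (suc t)) = even-odd-disjoint t

    block₂ : Mat
    block₂ r c = block₁ (suc r) (suc c) - block₁ 0 (suc c) * evenIndicator (suc r)

    deflate-odd : detℕ (suc m′) block₁ ≡ eigenvalue * detℕ m′ block₂
    deflate-odd = detℕ-deflate m′ block₁ evenIndicator eigenvalue evenIndicator refl refl eigen
      where
      drop-row0 : ∀ v a e w → v * (a - e * w) ≡ v * a - (v * e) * w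
      drop-row0 = solve-∀
      drop-zero : ∀ a w → a - 0ℤ * w ≡ a
      drop-zero = solve-∀
      shifted : ∀ r t → evenIndicator t * block₁ r t ≡ δ (parity (suc t)) 1 * parityBlock X (suc r) (suc t)
      shifted r t = begin
        evenIndicator t * (parityBlock X (suc r) (suc t) - parityBlock X 0 (suc t) * evenIndicator (suc r))
          ≡⟨ cong (λ o → evenIndicator t * (parityBlock X (suc r) (suc t) - o * evenIndicator (suc r))) (parityBlock-row0 t) ⟩
        evenIndicator t * (parityBlock X (suc r) (suc t) - δ 0 (parity (suc t)) * evenIndicator (suc r))
          ≡⟨ drop-row0 (evenIndicator t) _ _ _ ⟩
        evenIndicator t * parityBlock X (suc r) (suc t) - (evenIndicator t * δ 0 (parity (suc t))) * evenIndicator (suc r)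
          ≡⟨ cong (λ z → evenIndicator t * parityBlock X (suc r) (suc t) - z * evenIndicator (suc r)) (even-odd-disjoint t) ⟩
        evenIndicator t * parityBlock X (suc r) (suc t) - 0ℤ * evenIndicator (suc r)
          ≡⟨ drop-zero (evenIndicator t * parityBlock X (suc r) (suc t)) (evenIndicator (suc r)) ⟩
        evenIndicator t * parityBlock X (suc r) (suc t)
          ≡⟨ cong (_* parityBlock X (suc r) (suc t)) (sym (δ-parity-suc-1 t)) ⟩
        δ (parity (suc t)) 1 * parityBlock X (suc r) (suc t) ∎
        where open ≡-Reasoning
      eigen : ∀ r → r < suc m′ → sumℕ (suc m′) (λ t → evenIndicator t * block₁ r t) ≡ eigenvalue * evenIndicator r
      eigen r r<1+m′ = begin
        sumℕ (suc m′) (λ t → evenIndicator t * block₁ r t)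
          ≡⟨ sumℕ-cong (suc m′) _ _ (λ t _ → shifted r t) ⟩
        sumℕ (suc m′) (λ t → δ (parity (suc t)) 1 * parityBlock X (suc r) (suc t))
          ≡⟨ sym (ℤₚ.+-identityˡ _) ⟩
        sumℕ n (λ t → δ (parity t) 1 * parityBlock X (suc r) t)
          ≡⟨ parityIndicator-eigen 1 (inj₂ refl) (suc r) (s≤s r<1+m′) ⟩
        δ (parity (suc r)) 1 * eigenvalue
          ≡⟨ cong (_* eigenvalue) (δ-parity-suc-1 r) ⟩
        evenIndicator r * eigenvalue
          ≡⟨ ℤₚ.*-comm (evenIndicator r) eigenvalue ⟩
        eigenvalue * evenIndicator r ∎
        where open ≡-Reasoning

    parity-cancel : ∀ a b → a ≡ 0 ⊎ a ≡ 1 → b ≡ 0 ⊎ b ≡ 1 → δ a b - δ 0 b * δ a 0 - δ 1 b * δ a 1 ≡ 0ℤ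
    parity-cancel .0 .0 (inj₁ refl) (inj₁ refl) = refl
    parity-cancel .0 .1 (inj₁ refl) (inj₂ refl) = refl
    parity-cancel .1 .0 (inj₂ refl) (inj₁ refl) = refl
    parity-cancel .1 .1 (inj₂ refl) (inj₂ refl) = refl

    block₂≡scalar : ∀ r c → block₂ r c ≡ δ r c * X
    block₂≡scalar r c = begin
      (parityBlock X (suc² r) (suc² c) - P₀ (suc² c) * evenIndicator (suc² r))
        - (parityBlock X 1 (suc² c) - P₀ (suc² c) * evenIndicator 1) * evenIndicator (suc r)
        ≡⟨ cong₂ (λ u w → (parityBlock X (suc² r) (suc² c) - u * evenIndicator r) - (parityBlock X 1 (suc² c) - u * 0ℤ) * w)
                 (parityBlock-row0 (suc c)) (δ-parity-suc-0 r) ⟩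
      (δ r c * X + δ (parity r) (parity c) - δ 0 (parity c) * δ (parity r) 0)
        - ((0ℤ * X + δ 1 (parity c)) - δ 0 (parity c) * 0ℤ) * δ (parity r) 1
        ≡⟨ regroup (δ r c) X (δ (parity r) (parity c)) (δ 0 (parity c)) (δ (parity r) 0) (δ 1 (parity c)) (δ (parity r) 1) ⟩
      δ r c * X + (δ (parity r) (parity c) - δ 0 (parity c) * δ (parity r) 0 - δ 1 (parity c) * δ (parity r) 1)
        ≡⟨ cong (λ s → δ r c * X + s) (parity-cancel (parity r) (parity c) (parity≡0⊎1 r) (parity≡0⊎1 c)) ⟩
      δ r c * X + 0ℤ
        ≡⟨ ℤₚ.+-identityʳ _ ⟩
      δ r c * X ∎
      where
      open ≡-Reasoning
      suc² : ℕ → ℕ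
      suc² i = suc (suc i)
      P₀ : ℕ → ℤ
      P₀ = parityBlock X 0
      regroup : ∀ a X p e₀ v₀ e₁ v₁ → (a * X + p - e₀ * v₀) - ((0ℤ * X + e₁) - e₀ * 0ℤ) * v₁ ≡ a * X + (p - e₀ * v₀ - e₁ * v₁)
      regroup = solve-∀

    det-block₂ : detℕ m′ block₂ ≡ X ^ m′
    det-block₂ = begin
      detℕ m′ block₂                    ≡⟨ cong (λ k → detℕ k block₂) (sym (ℕₚ.+-identityʳ m′)) ⟩
      detℕ (m′ ℕ.+ 0) block₂            ≡⟨ detℕ-peelDiagonal m′ 0 block₂ X offDiagonal diagonal ⟩
      X ^ m′ * 1ℤ                       ≡⟨ ℤₚ.*-identityʳ _ ⟩
      X ^ m′                            ∎
      where
      open ≡-Reasoning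
      offDiagonal : ∀ r c → r < m′ → c < m′ ℕ.+ 0 → r ≢ c → block₂ r c ≡ 0ℤ
      offDiagonal r c _ _ r≢c = trans (block₂≡scalar r c) (trans (cong (_* X) (δ-≢ r≢c)) (ℤₚ.*-zeroˡ X))
      diagonal : ∀ r → r < m′ → block₂ r r ≡ X
      diagonal r _ = trans (block₂≡scalar r r) (trans (cong (_* X) (δ-refl r)) (ℤₚ.*-identityˡ X))

    det-parityBlock : detℕ n (parityBlock X) ≡ eigenvalue * (eigenvalue * X ^ m′)
    det-parityBlock = trans deflate-even (cong (eigenvalue *_) (trans deflate-odd (cong (eigenvalue *_) det-block₂)))

  ⌊≟⌋≡≡ᵇ : ∀ a b → ⌊ a ℕ.≟ b ⌋ ≡ (a ≡ᵇ b)
  ⌊≟⌋≡≡ᵇ a b with a ℕ.≟ b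
  ... | yes refl = sym (≡ᵇ-refl a)
  ... | no  a≢b  = sym (≢⇒≡ᵇ≡false a≢b)

  linked-identityʳ : ∀ k → linked k identityKind ≡ true
  linked-identityʳ identityKind       = refl
  linked-identityʳ rotationKind       = refl
  linked-identityʳ (reflectionKind _) = refl

  module Spectrum (m′ q : ℕ) (n≡2q : suc (suc m′) ≡ q ℕ.* 2) (x : ℤ) where
    n : ℕ
    n = suc (suc m′)

    open EvenOrder (suc m′) q n≡2q using (kindℕ; adjℕ; csepAdj-enum; kindℕ-rotation; kindℕ-reflection; parity-n+)

    2n : ℕ
    2n = n ℕ.+ n

    deg : ℕ → ℤ
    deg r = sumℕ 2n (λ t → b2ℤ (adjℕ r t))

    charMat : Mat
    charMat r c = if r ≡ᵇ c then x - deg r else b2ℤ (adjℕ r c)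

    adjℕ-self : ∀ s → adjℕ s s ≡ false
    adjℕ-self s = cong (λ b → if b then false else linked (kindℕ s) (kindℕ s)) (≡ᵇ-refl s)

    adjℕ-≢ : ∀ s t → s ≢ t → adjℕ s t ≡ linked (kindℕ s) (kindℕ t)
    adjℕ-≢ s t s≢t = cong (λ b → if b then false else linked (kindℕ s) (kindℕ t)) (≢⇒≡ᵇ≡false s≢t)

    charMat-diag : ∀ r → charMat r r ≡ x - deg r
    charMat-diag r = cong (λ b → if b then x - deg r else b2ℤ (adjℕ r r)) (≡ᵇ-refl r)

    charMat-off : ∀ r c → r ≢ c → charMat r c ≡ b2ℤ (linked (kindℕ r) (kindℕ c))
    charMat-off r c r≢c =
      trans (cong (λ b → if b then x - deg r else b2ℤ (adjℕ r c)) (≢⇒≡ᵇ≡false r≢c)) (cong b2ℤ (adjℕ-≢ r c r≢c))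

    charMat-split : ∀ r t → charMat r t ≡ b2ℤ (adjℕ r t) + δ r t * (x - deg r)
    charMat-split r t with r ℕ.≟ t
    ... | yes refl = begin
      charMat r r                          ≡⟨ charMat-diag r ⟩
      x - deg r                            ≡⟨ ℤₚ.+-identityˡ _ ⟨
      0ℤ + (x - deg r)                     ≡⟨ cong₂ (λ a d → b2ℤ a + d) (sym (adjℕ-self r)) (sym (ℤₚ.*-identityˡ _)) ⟩
      b2ℤ (adjℕ r r) + 1ℤ * (x - deg r)    ≡⟨ cong (λ d → b2ℤ (adjℕ r r) + d * (x - deg r)) (sym (δ-refl r)) ⟩
      b2ℤ (adjℕ r r) + δ r r * (x - deg r) ∎
      where open ≡-Reasoning
    ... | no  r≢t = begin
      charMat r t                          ≡⟨ cong (λ b → if b then x - deg r else b2ℤ (adjℕ r t)) (≢⇒≡ᵇ≡false r≢t) ⟩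
      b2ℤ (adjℕ r t)                       ≡⟨ ℤₚ.+-identityʳ _ ⟨
      b2ℤ (adjℕ r t) + 0ℤ                  ≡⟨ cong (λ s → b2ℤ (adjℕ r t) + s) (sym (ℤₚ.*-zeroˡ (x - deg r))) ⟩
      b2ℤ (adjℕ r t) + 0ℤ * (x - deg r)    ≡⟨ cong (λ d → b2ℤ (adjℕ r t) + d * (x - deg r)) (sym (δ-≢ r≢t)) ⟩
      b2ℤ (adjℕ r t) + δ r t * (x - deg r) ∎
      where open ≡-Reasoning

    rowSum-charMat : ∀ r → r < 2n → sumℕ 2n (charMat r) ≡ x
    rowSum-charMat r r<2n = begin
      sumℕ 2n (charMat r)                                                        ≡⟨ sumℕ-cong 2n _ _ (λ t _ → charMat-split r t) ⟩
      sumℕ 2n (λ t → b2ℤ (adjℕ r t) + δ r t * (x - deg r))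
        ≡⟨ sumℕ-+ 2n (λ t → b2ℤ (adjℕ r t)) (λ t → δ r t * (x - deg r)) ⟩
      deg r + sumℕ 2n (λ t → δ r t * (x - deg r))
        ≡⟨ cong (λ s → deg r + s) (sumℕ-δ 2n r (λ _ → x - deg r) r<2n) ⟩
      deg r + (x - deg r)                                                        ≡⟨ cancel x (deg r) ⟩
      x                                                                          ∎
      where
      open ≡-Reasoning
      cancel : ∀ x d → d + (x - d) ≡ x
      cancel = solve-∀

    n≤n+ : ∀ t → n ≤ n ℕ.+ t
    n≤n+ t = ℕₚ.m≤m+n n t

    deg-rotation : ∀ r → r ≢ 0 → r < n → deg r ≡ + suc m′
    deg-rotation r r≢0 r<n = begin
      deg r                                                        ≡⟨ sumℕ-split n n (λ t → b2ℤ (adjℕ r t)) ⟩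
      sumℕ n (λ t → b2ℤ (adjℕ r t)) + sumℕ n (λ t → b2ℤ (adjℕ r (n ℕ.+ t))) ≡⟨ cong₂ _+_ rotations reflections ⟩
      (+ n - 1ℤ) + 0ℤ                                              ≡⟨ cong (λ k → k - 1ℤ + 0ℤ) (ℤₚ.pos-+ 1 (suc m′)) ⟩
      1ℤ + + suc m′ - 1ℤ + 0ℤ                                      ≡⟨ simplify (+ suc m′) ⟩
      + suc m′                                                     ∎
      where
      open ≡-Reasoning
      simplify : ∀ a → 1ℤ + a - 1ℤ + 0ℤ ≡ a
      simplify = solve-∀
      rotation-entry : ∀ t → t < n → b2ℤ (adjℕ r t) ≡ 1ℤ - δ r t
      rotation-entry t t<n with r ℕ.≟ t
      ... | yes refl = trans (cong b2ℤ (adjℕ-self r)) (cong (λ d → 1ℤ - d) (sym (δ-refl r)))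
      rotation-entry zero    _   | no r≢t =
        trans (cong b2ℤ (trans (adjℕ-≢ r 0 r≢t) (cong (λ k → linked k identityKind) (kindℕ-rotation r r≢0 r<n))))
              (cong (λ d → 1ℤ - d) (sym (δ-≢ r≢t)))
      rotation-entry (suc t) t<n | no r≢t =
        trans (cong b2ℤ (trans (adjℕ-≢ r (suc t) r≢t) (cong₂ linked (kindℕ-rotation r r≢0 r<n) (kindℕ-rotation (suc t) (λ ()) t<n))))
              (cong (λ d → 1ℤ - d) (sym (δ-≢ r≢t)))
      rotations : sumℕ n (λ t → b2ℤ (adjℕ r t)) ≡ + n - 1ℤ
      rotations = trans (sumℕ-cong n _ (λ t → 1ℤ - δ r t) rotation-entry)
                        (trans (sumℕ-- n (λ _ → 1ℤ) (δ r)) (cong₂ _-_ (sumℕ-1 n) (sumℕ-δ′ n r r<n)))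
      reflections : sumℕ n (λ t → b2ℤ (adjℕ r (n ℕ.+ t))) ≡ 0ℤ
      reflections = sumℕ-≡0 n _ λ t _ → cong b2ℤ (trans
        (adjℕ-≢ r (n ℕ.+ t) (λ r≡n+t → ℕₚ.<⇒≱ r<n (subst (n ≤_) (sym r≡n+t) (n≤n+ t))))
        (cong₂ linked (kindℕ-rotation r r≢0 r<n) (kindℕ-reflection (n ℕ.+ t) (n≤n+ t))))

    adjℕ-reflections : ∀ r t → r ≢ t → b2ℤ (adjℕ (n ℕ.+ r) (n ℕ.+ t)) ≡ δ (parity r) (parity t)
    adjℕ-reflections r t r≢t = begin
      b2ℤ (adjℕ (n ℕ.+ r) (n ℕ.+ t))
        ≡⟨ cong b2ℤ (adjℕ-≢ (n ℕ.+ r) (n ℕ.+ t) (λ e → r≢t (ℕₚ.+-cancelˡ-≡ n r t e))) ⟩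
      b2ℤ (linked (kindℕ (n ℕ.+ r)) (kindℕ (n ℕ.+ t)))
        ≡⟨ cong₂ (λ a b → b2ℤ (linked a b)) (kindℕ-reflection (n ℕ.+ r) (n≤n+ r)) (kindℕ-reflection (n ℕ.+ t) (n≤n+ t)) ⟩
      b2ℤ ⌊ parity (n ℕ.+ r) ℕ.≟ parity (n ℕ.+ t) ⌋
        ≡⟨ cong b2ℤ (⌊≟⌋≡≡ᵇ (parity (n ℕ.+ r)) (parity (n ℕ.+ t))) ⟩
      δ (parity (n ℕ.+ r)) (parity (n ℕ.+ t))
        ≡⟨ cong₂ δ (parity-n+ r) (parity-n+ t) ⟩
      δ (parity r) (parity t) ∎
      where open ≡-Reasoning

    deg-reflection : ∀ r → r < n → deg (n ℕ.+ r) ≡ + q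
    deg-reflection r r<n = begin
      deg (n ℕ.+ r)                                                ≡⟨ sumℕ-split n n (λ t → b2ℤ (adjℕ (n ℕ.+ r) t)) ⟩
      sumℕ n (λ t → b2ℤ (adjℕ (n ℕ.+ r) t)) + sumℕ n (λ t → b2ℤ (adjℕ (n ℕ.+ r) (n ℕ.+ t))) ≡⟨ cong₂ _+_ rotations reflections ⟩
      1ℤ + (+ q * 1ℤ - 1ℤ)                                         ≡⟨ simplify (+ q) ⟩
      + q                                                          ∎
      where
      open ≡-Reasoning
      simplify : ∀ Q → 1ℤ + (Q * 1ℤ - 1ℤ) ≡ Q
      simplify = solve-∀
      n+r≢0 : n ℕ.+ r ≢ 0
      n+r≢0 ()
      rotation-entry : ∀ t → t < n → b2ℤ (adjℕ (n ℕ.+ r) t) ≡ δ 0 t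
      rotation-entry zero    _   = cong b2ℤ (trans (adjℕ-≢ (n ℕ.+ r) 0 n+r≢0) (linked-identityʳ (kindℕ (n ℕ.+ r))))
      rotation-entry (suc t) t<n =
        cong b2ℤ (trans (adjℕ-≢ (n ℕ.+ r) (suc t) (λ e → ℕₚ.<⇒≱ t<n (subst (n ≤_) e (n≤n+ r))))
                        (cong₂ linked (kindℕ-reflection (n ℕ.+ r) (n≤n+ r)) (kindℕ-rotation (suc t) (λ ()) t<n)))
      rotations : sumℕ n (λ t → b2ℤ (adjℕ (n ℕ.+ r) t)) ≡ 1ℤ
      rotations = trans (sumℕ-cong n _ (δ 0) rotation-entry) (sumℕ-δ′ n 0 (s≤s z≤n))
      reflection-entry : ∀ t → t < n → b2ℤ (adjℕ (n ℕ.+ r) (n ℕ.+ t)) ≡ δ (parity r) (parity t) - δ r t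
      reflection-entry t _ with r ℕ.≟ t
      ... | yes refl = trans (cong b2ℤ (adjℕ-self (n ℕ.+ r)))
                             (trans (sym (ℤₚ.+-inverseʳ 1ℤ)) (cong₂ _-_ (sym (δ-refl (parity r))) (sym (δ-refl r))))
      ... | no  r≢t  = trans (adjℕ-reflections r t r≢t)
                             (trans (sym (ℤₚ.+-identityʳ _)) (cong (λ d → δ (parity r) (parity t) - d) (sym (δ-≢ r≢t))))
      reflections : sumℕ n (λ t → b2ℤ (adjℕ (n ℕ.+ r) (n ℕ.+ t))) ≡ + q * 1ℤ - 1ℤ
      reflections = begin
        sumℕ n (λ t → b2ℤ (adjℕ (n ℕ.+ r) (n ℕ.+ t)))                    ≡⟨ sumℕ-cong n _ _ reflection-entry ⟩
        sumℕ n (λ t → δ (parity r) (parity t) - δ r t)                    ≡⟨ sumℕ-- n (λ t → δ (parity r) (parity t)) (δ r) ⟩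
        sumℕ n (λ t → δ (parity r) (parity t)) - sumℕ n (δ r)             ≡⟨ cong₂ _-_ sameParity (sumℕ-δ′ n r r<n) ⟩
        + q * 1ℤ - 1ℤ                                                     ∎
        where
        sameParity : sumℕ n (λ t → δ (parity r) (parity t)) ≡ + q * 1ℤ
        sameParity = trans (cong (λ k → sumℕ k (λ t → δ (parity r) (parity t))) n≡2q)
                           (trans (sumℕ-parity q (δ (parity r))) (cong (+ q *_) (δ-parity-0+1 r)))

    charMat-identityRow : ∀ c → c ≢ 0 → charMat 0 c ≡ 1ℤ
    charMat-identityRow c c≢0 = charMat-off 0 c (λ e → c≢0 (sym e))

    charMat-identityColumn : ∀ r → r ≢ 0 → charMat r 0 ≡ 1ℤ
    charMat-identityColumn r r≢0 = trans (charMat-off r 0 r≢0) (cong b2ℤ (linked-identityʳ (kindℕ r)))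

    charMat-rotations : ∀ r c → r ≢ 0 → c ≢ 0 → r < n → c < n → r ≢ c → charMat r c ≡ 1ℤ
    charMat-rotations r c r≢0 c≢0 r<n c<n r≢c =
      trans (charMat-off r c r≢c) (cong b2ℤ (cong₂ linked (kindℕ-rotation r r≢0 r<n) (kindℕ-rotation c c≢0 c<n)))

    charMat-rotation-reflection : ∀ r c → r ≢ 0 → r < n → n ≤ c → charMat r c ≡ 0ℤ
    charMat-rotation-reflection r c r≢0 r<n n≤c =
      trans (charMat-off r c (λ e → ℕₚ.<⇒≱ r<n (subst (n ≤_) (sym e) n≤c)))
            (cong b2ℤ (cong₂ linked (kindℕ-rotation r r≢0 r<n) (kindℕ-reflection c n≤c)))

    charMat-rotation-diag : ∀ r → r ≢ 0 → r < n → charMat r r ≡ x - + suc m′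
    charMat-rotation-diag r r≢0 r<n = trans (charMat-diag r) (cong (λ d → x - d) (deg-rotation r r≢0 r<n))

    X : ℤ
    X = x - + q - 1ℤ

    charMat-reflections : ∀ r t → r < n → t < n → charMat (n ℕ.+ r) (n ℕ.+ t) ≡ parityBlock X r t
    charMat-reflections r t r<n _ with r ℕ.≟ t
    ... | yes refl = begin
      charMat (n ℕ.+ r) (n ℕ.+ r)        ≡⟨ charMat-diag (n ℕ.+ r) ⟩
      x - deg (n ℕ.+ r)                  ≡⟨ cong (λ d → x - d) (deg-reflection r r<n) ⟩
      x - + q                            ≡⟨ shift x (+ q) ⟩
      1ℤ * X + 1ℤ                        ≡⟨ cong₂ (λ a b → a * X + b) (sym (δ-refl r)) (sym (δ-refl (parity r))) ⟩
      parityBlock X r r                  ∎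
      where
      open ≡-Reasoning
      shift : ∀ x Q → x - Q ≡ 1ℤ * (x - Q - 1ℤ) + 1ℤ
      shift = solve-∀
    ... | no  r≢t = begin
      charMat (n ℕ.+ r) (n ℕ.+ t)
        ≡⟨ cong (λ b → if b then x - deg (n ℕ.+ r) else b2ℤ (adjℕ (n ℕ.+ r) (n ℕ.+ t))) (≢⇒≡ᵇ≡false (λ e → r≢t (ℕₚ.+-cancelˡ-≡ n r t e))) ⟩
      b2ℤ (adjℕ (n ℕ.+ r) (n ℕ.+ t))     ≡⟨ adjℕ-reflections r t r≢t ⟩
      δ (parity r) (parity t)            ≡⟨ ℤₚ.+-identityˡ _ ⟨
      0ℤ + δ (parity r) (parity t)       ≡⟨ cong (_+ δ (parity r) (parity t)) (sym (trans (cong (_* X) (δ-≢ r≢t)) (ℤₚ.*-zeroˡ X))) ⟩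
      parityBlock X r t                  ∎
      where open ≡-Reasoning

    charMat₁ : Mat
    charMat₁ r c = charMat (suc r) (suc c) - charMat 0 (suc c) * 1ℤ

    deflate-allOnes : detℕ 2n charMat ≡ x * detℕ (suc m′ ℕ.+ n) charMat₁
    deflate-allOnes = detℕ-deflate (suc m′ ℕ.+ n) charMat (λ _ → 1ℤ) x (λ _ → 1ℤ) refl refl λ r r<2n →
      trans (sumℕ-cong 2n _ (charMat r) (λ t _ → ℤₚ.*-identityˡ (charMat r t)))
            (trans (rowSum-charMat r r<2n) (sym (ℤₚ.*-identityʳ x)))

    charMat₂ : Mat
    charMat₂ r c = charMat₁ (suc r) (suc c) - charMat₁ 0 (suc c) * 1ℤ

    deflate-identityVertex : detℕ (suc m′ ℕ.+ n) charMat₁ ≡ (x - + 2n) * detℕ (m′ ℕ.+ n) charMat₂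
    deflate-identityVertex = detℕ-deflate (m′ ℕ.+ n) charMat₁ (λ _ → 1ℤ) (x - + 2n) (λ _ → 1ℤ) refl refl eigen
      where
      K : ℕ
      K = m′ ℕ.+ n
      rearrange : ∀ x k → x - 1ℤ - (1ℤ + k) ≡ (x - (+ 2 + k)) * 1ℤ
      rearrange = solve-∀
      peel : ∀ s → s ≡ 1ℤ + s - 1ℤ
      peel = solve-∀
      eigen : ∀ r → r < suc K → sumℕ (suc K) (λ t → 1ℤ * charMat₁ r t) ≡ (x - + 2n) * 1ℤ
      eigen r r<1+K = begin
        sumℕ (suc K) (λ t → 1ℤ * charMat₁ r t)                                  ≡⟨ sumℕ-cong (suc K) _ _ (λ t _ → entry t) ⟩
        sumℕ (suc K) (λ t → charMat (suc r) (suc t) - 1ℤ)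
          ≡⟨ sumℕ-- (suc K) (λ t → charMat (suc r) (suc t)) (λ _ → 1ℤ) ⟩
        sumℕ (suc K) (λ t → charMat (suc r) (suc t)) - sumℕ (suc K) (λ _ → 1ℤ) ≡⟨ cong₂ _-_ offIdentity (sumℕ-1 (suc K)) ⟩
        x - 1ℤ - + suc K                                                        ≡⟨ cong (λ k → x - 1ℤ - k) (ℤₚ.pos-+ 1 K) ⟩
        x - 1ℤ - (1ℤ + + K)                                                     ≡⟨ rearrange x (+ K) ⟩
        (x - (+ 2 + + K)) * 1ℤ                                                  ≡⟨ cong (λ k → (x - k) * 1ℤ) (sym (ℤₚ.pos-+ 2 K)) ⟩
        (x - + 2n) * 1ℤ                                                         ∎
        where
        open ≡-Reasoning
        entry : ∀ t → 1ℤ * charMat₁ r t ≡ charMat (suc r) (suc t) - 1ℤ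
        entry t = trans (ℤₚ.*-identityˡ _) (cong (λ o → charMat (suc r) (suc t) - o * 1ℤ) (charMat-identityRow (suc t) (λ ())))
        offIdentity : sumℕ (suc K) (λ t → charMat (suc r) (suc t)) ≡ x - 1ℤ
        offIdentity = trans (peel _) (cong (_- 1ℤ)
          (trans (cong (_+ sumℕ (suc K) (λ t → charMat (suc r) (suc t))) (sym (charMat-identityColumn (suc r) (λ ()))))
                 (rowSum-charMat (suc r) (s≤s r<1+K))))

    charMat₂-entry : ∀ r c → charMat₂ r c ≡ charMat (suc (suc r)) (suc (suc c)) - charMat 1 (suc (suc c))
    charMat₂-entry r c = cancel (charMat (suc (suc r)) (suc (suc c))) (charMat 1 (suc (suc c))) (charMat 0 (suc (suc c)))
      where
      cancel : ∀ a b o → (a - o * 1ℤ) - (b - o * 1ℤ) * 1ℤ ≡ a - b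
      cancel = solve-∀

    reflectionBlock : Mat
    reflectionBlock r c = charMat₂ (m′ ℕ.+ r) (m′ ℕ.+ c)

    peel-rotations : detℕ (m′ ℕ.+ n) charMat₂ ≡ (x - + n) ^ m′ * detℕ n reflectionBlock
    peel-rotations = detℕ-peelDiagonal m′ n charMat₂ (x - + n) offDiagonal diagonal
      where
      offDiagonal : ∀ r c → r < m′ → c < m′ ℕ.+ n → r ≢ c → charMat₂ r c ≡ 0ℤ
      offDiagonal r c r<m′ _ r≢c with ℕₚ.<-≤-connex c m′
      ... | inj₁ c<m′ = trans (charMat₂-entry r c) (cong₂ _-_
              (charMat-rotations (suc (suc r)) (suc (suc c)) (λ ()) (λ ()) (s≤s (s≤s r<m′)) (s≤s (s≤s c<m′))
                                 (λ e → r≢c (ℕₚ.suc-injective (ℕₚ.suc-injective e))))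
              (charMat-rotations 1 (suc (suc c)) (λ ()) (λ ()) (s≤s (s≤s z≤n)) (s≤s (s≤s c<m′)) (λ ())))
      ... | inj₂ m′≤c = trans (charMat₂-entry r c) (cong₂ _-_
              (charMat-rotation-reflection (suc (suc r)) (suc (suc c)) (λ ()) (s≤s (s≤s r<m′)) (s≤s (s≤s m′≤c)))
              (charMat-rotation-reflection 1 (suc (suc c)) (λ ()) (s≤s (s≤s z≤n)) (s≤s (s≤s m′≤c))))
      diagonal : ∀ r → r < m′ → charMat₂ r r ≡ x - + n
      diagonal r r<m′ = begin
        charMat₂ r r                                               ≡⟨ charMat₂-entry r r ⟩
        charMat (suc (suc r)) (suc (suc r)) - charMat 1 (suc (suc r)) ≡⟨ cong₂ _-_ (charMat-rotation-diag (suc (suc r)) (λ ()) (s≤s (s≤s r<m′)))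
                                                                              (charMat-rotations 1 (suc (suc r)) (λ ()) (λ ()) (s≤s (s≤s z≤n)) (s≤s (s≤s r<m′)) (λ ())) ⟩
        x - + suc m′ - 1ℤ                                          ≡⟨ regroup x (+ suc m′) ⟩
        x - (1ℤ + + suc m′)                                        ≡⟨ cong (λ d → x - d) (sym (ℤₚ.pos-+ 1 (suc m′))) ⟩
        x - + n                                                    ∎
        where
        open ≡-Reasoning
        regroup : ∀ x k → x - k - 1ℤ ≡ x - (1ℤ + k)
        regroup = solve-∀

    reflectionBlock≡parityBlock : ∀ r c → r < n → c < n → reflectionBlock r c ≡ parityBlock X r c
    reflectionBlock≡parityBlock r c r<n c<n = begin
      reflectionBlock r c                                        ≡⟨ charMat₂-entry (m′ ℕ.+ r) (m′ ℕ.+ c) ⟩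
      charMat (n ℕ.+ r) (n ℕ.+ c) - charMat 1 (n ℕ.+ c)          ≡⟨ cong₂ _-_ (charMat-reflections r c r<n c<n)
                                                                              (charMat-rotation-reflection 1 (n ℕ.+ c) (λ ()) (s≤s (s≤s z≤n)) (n≤n+ c)) ⟩
      parityBlock X r c - 0ℤ                                     ≡⟨ ℤₚ.+-identityʳ _ ⟩
      parityBlock X r c                                          ∎
      where open ≡-Reasoning

    det-charMat : detℕ 2n charMat ≡ x * ((x - + 2n) * ((x - + n) ^ m′ * ((x - 1ℤ) * ((x - 1ℤ) * X ^ m′))))
    det-charMat = begin
      detℕ 2n charMat                                          ≡⟨ deflate-allOnes ⟩
      x * detℕ (suc m′ ℕ.+ n) charMat₁                         ≡⟨ cong (x *_) deflate-identityVertex ⟩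
      x * ((x - + 2n) * detℕ (m′ ℕ.+ n) charMat₂)              ≡⟨ cong (λ d → x * ((x - + 2n) * d)) peel-rotations ⟩
      x * ((x - + 2n) * ((x - + n) ^ m′ * detℕ n reflectionBlock))
        ≡⟨ cong (λ d → x * ((x - + 2n) * ((x - + n) ^ m′ * d))) (trans (detℕ-cong< n _ _ reflectionBlock≡parityBlock) det-parityBlock) ⟩
      x * ((x - + 2n) * ((x - + n) ^ m′ * (eigenvalue * (eigenvalue * X ^ m′))))
        ≡⟨ cong (λ λ₁ → x * ((x - + 2n) * ((x - + n) ^ m′ * (λ₁ * (λ₁ * X ^ m′))))) (shift x (+ q)) ⟩
      x * ((x - + 2n) * ((x - + n) ^ m′ * ((x - 1ℤ) * ((x - 1ℤ) * X ^ m′)))) ∎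
      where
      open ≡-Reasoning
      open ParityBlock m′ q n≡2q X using (eigenvalue; det-parityBlock)
      shift : ∀ x Q → x - Q - 1ℤ + Q ≡ x - 1ℤ
      shift = solve-∀

    ⌊≟⌋≡toℕ≡ᵇ : ∀ {k} (i j : Fin k) → ⌊ i Finₚ.≟ j ⌋ ≡ (toℕ i ≡ᵇ toℕ j)
    ⌊≟⌋≡toℕ≡ᵇ i j with i Finₚ.≟ j
    ... | yes refl = sym (≡ᵇ-refl (toℕ i))
    ... | no  i≢j  = sym (≢⇒≡ᵇ≡false (λ e → i≢j (Finₚ.toℕ-injective e)))

    xI-L≡charMat : ∀ i j → (if ⌊ i Finₚ.≟ j ⌋ then x else 0ℤ) - laplacianCSEP (D2n (suc m′)) i j ≡ charMat (toℕ i) (toℕ j)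
    xI-L≡charMat i j = by-diagonal ⌊ i Finₚ.≟ j ⌋ (toℕ i ≡ᵇ toℕ j) (⌊≟⌋≡toℕ≡ᵇ i j)
      (sumFin≡sumℕ 2n _ (λ t → b2ℤ (adjℕ (toℕ i) t)) (λ k → cong b2ℤ (sym (csepAdj-enum i k))))
      (cong b2ℤ (csepAdj-enum i j))
      where
      by-diagonal : ∀ (b b′ : Bool) {S S′ A A′} → b ≡ b′ → S ≡ S′ → A ≡ A′ →
        (if b then x else 0ℤ) - (if b then S else - A) ≡ (if b′ then x - S′ else A′)
      by-diagonal true  .true  refl S≡S′ _    = cong (λ d → x - d) S≡S′
      by-diagonal false .false refl _    A≡A′ = trans (ℤₚ.+-identityˡ (- - _)) (trans (ℤₚ.neg-involutive _) A≡A′)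

    charPoly≡det-charMat : charPolyAt (laplacianCSEP (D2n (suc m′))) x ≡ detℕ 2n charMat
    charPoly≡det-charMat = det≡detℕ 2n _ charMat (λ r c → sym (xI-L≡charMat r c))

open import Data.Nat using (zero; s≤s)
open import Data.Nat.Divisibility using (divides)
open import Data.Nat.DivMod using (m*n/n≡m)
import Data.Nat.Properties as ℕₚ
open import Data.Integer using (1ℤ)
open import Data.Integer.Tactic.RingSolver using (solve-∀)
open import Relation.Binary.PropositionalEquality using (sym; cong; cong₂; trans; module ≡-Reasoning)
open Determinant using (detℕ)
open CharacteristicPolynomial using (module Spectrum)

mainTheorem4 : (m : ℕ) → 4 ≤ suc m → 2 ∣ suc m → (x : ℤ) →
    charPolyAt (laplacianCSEP (D2n m)) x ≡
      x * (x - + 1) ^ 2 * (x - (+ (suc m / 2) Data.Integer.+ + 1)) ^ (suc m Data.Nat.∸ 2)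
        * (x - + (2 Data.Nat.* suc m)) * (x - + suc m) ^ (suc m Data.Nat.∸ 2)
-- The computation works for every even n ≥ 2; the hypothesis 4 ≤ n only excludes n = 1.
mainTheorem4 zero       (s≤s ()) _                 _
mainTheorem4 (suc m′)   _        (divides q n≡2q) x = begin
  charPolyAt (laplacianCSEP (D2n (suc m′))) x                                  ≡⟨ charPoly≡det-charMat ⟩
  detℕ 2n charMat                                                              ≡⟨ det-charMat ⟩
  x * ((x - + 2n) * ((x - + n) ^ m′ * ((x - 1ℤ) * ((x - 1ℤ) * X ^ m′))))      ≡⟨ reorder x (x - 1ℤ) (X ^ m′) (x - + 2n) ((x - + n) ^ m′) ⟩
  x * (x - 1ℤ) ^ 2 * X ^ m′ * (x - + 2n) * (x - + n) ^ m′
    ≡⟨ cong₂ (λ P B → x * (x - 1ℤ) ^ 2 * P * B * (x - + n) ^ m′) X-factor 2n-factor ⟩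
  x * (x - 1ℤ) ^ 2 * (x - (+ (n / 2) Data.Integer.+ + 1)) ^ m′ * (x - + (2 Data.Nat.* n)) * (x - + n) ^ m′ ∎
  where
  open ≡-Reasoning
  open Spectrum m′ q n≡2q x
  reorder : ∀ x a p b c → x * (b * (c * (a * (a * p)))) ≡ x * (a * (a * 1ℤ)) * p * b * c
  reorder = solve-∀
  half : n / 2 ≡ q
  half = trans (cong (_/ 2) n≡2q) (m*n/n≡m q 2)
  regroup : ∀ x Q → x - Q - 1ℤ ≡ x - (Q Data.Integer.+ 1ℤ)
  regroup = solve-∀
  X-factor : X ^ m′ ≡ (x - (+ (n / 2) Data.Integer.+ + 1)) ^ m′
  X-factor = cong (_^ m′) (trans (regroup x (+ q)) (cong (λ Q → x - (+ Q Data.Integer.+ + 1)) (sym half)))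
  2n-factor : x - + 2n ≡ x - + (2 Data.Nat.* n)
  2n-factor = cong (λ k → x - + (n Data.Nat.+ k)) (sym (ℕₚ.+-identityʳ n))
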